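{- In the setting below, assume $\Gamma(m,C):=4\sqrt{2(C+\log m)m}<m/4$. Then for any $S\subseteq\{1,\dots,c\}$, \[ \mathop{\mathbb{E}}_{\Pi}\Big[\sum_{\mathbf{v}_S\in V_{(2S-1)\cup2S}}p_S(\mathbf{v}_S\mid\Pi)^2\Big]\le\big(\Gamma(m,C)+6\big)^{|S|}. \]
   Context: Setting: integers $m,c,C>0$; fixed layers $V_0=\{v_0\}$, $V_1,\dots,V_{2c}$ with $|V_i|=m$ for $i\ge1$; independent uniformly random edge sets $E_1$ (one edge from $v_0$ to $V_1$) and $E_i$ ($2\le i\le2c$) a perfect matching between $V_{i-1}$ and $V_i$; $G_i(u)$ is the neighbor in $V_i$ of $u\in V_{i-1}$ via $E_i$. Alice holds $E_2,E_4,\dots,E_{2c}$ and sends a single message $\Pi$ of at most $C$ bits depending on her input. For $S\subseteq\{1,\dots,c\}$, $2S-1=\{2i-1:i\in S\}$, $2S=\{2i:i\in S\}$, $V_{(2S-1)\cup2S}$ is the product of the layers with these indices, and for $\mathbf{v}_S\in V_{(2S-1)\cup2S}$, $p_S(\mathbf{v}_S\mid\Pi)=\Pr[\forall i\in S:\ G_{2i}(v_{2i-1})=v_{2i}\mid\Pi]$. Logarithms are base 2. -}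

module Defs where

open import Data.Bool using (Bool; true; false; T)
open import Data.Nat as ℕ using (ℕ; zero; suc)
open import Data.Integer using (+_)
open import Data.Fin using (Fin; _≟_)
open import Data.Fin.Subset using (Subset)
open import Data.Vec using (Vec; []; _∷_; lookup; toList)
open import Data.List using (List; []; _∷_; map; concatMap; filter; length; foldr)
open import Data.Product using (_×_; _,_)
open import Data.Unit using (⊤; tt)
open import Data.Rational using (ℚ; 0ℚ; 1ℚ; _+_; _*_; _/_)
open import Relation.Nullary.Decidable using (does; ⌊_⌋)
import Data.List.Relation.Unary.Unique.DecPropositional as UDec

sumℚ : List ℚ → ℚ
sumℚ = foldr _+_ 0ℚ

_^ℚ_ : ℚ → ℕ → ℚ
q ^ℚ zero  = 1ℚ
q ^ℚ suc n = q * (q ^ℚ n)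

toℚ : ℕ → ℚ
toℚ n = + n / 1

-- k / n as a rational, with the (never used) convention k / 0 = 0
ratio : ℕ → ℕ → ℚ
ratio k zero    = 0ℚ
ratio k (suc n) = + k / suc n

allVecs : {A : Set} → List A → (k : ℕ) → List (Vec A k)
allVecs xs zero    = [] ∷ []
allVecs xs (suc k) = concatMap (λ x → map (x ∷_) (allVecs xs k)) xs

allFin : (m : ℕ) → List (Fin m)
allFin m = Data.List.allFin m
  where import Data.List

count : {A : Set} → (A → Bool) → List A → ℕ
count p xs = length (filter (λ x → Data.Bool.Properties.T? (p x)) xs)
  where import Data.Bool.Properties

-- A perfect matching between two layers of size m, given as the map
-- u ↦ G(u) : Fin m → Fin m (a bijection), stored as a vector.
Matching : ℕ → Set
Matching m = Vec (Fin m) m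

allMatchings : (m : ℕ) → List (Matching m)
allMatchings m = filter (λ σ → unique? (toList σ)) (allVecs (allFin m) m)
  where open UDec (_≟_ {m}) using (unique?)

-- Alice's input (E₂, E₄, …, E_{2c}); the i-th entry (i : Fin c, standing for
-- the paper's index i+1) is the matching E_{2(i+1)} from V_{2i+1} to V_{2i+2}.
AliceInput : ℕ → ℕ → Set
AliceInput m c = Vec (Matching m) c

-- all of Alice's inputs, each with equal probability (uniform distribution)
allInputs : (m c : ℕ) → List (AliceInput m c)
allInputs m c = allVecs (allMatchings m) c

-- Points v_S of V_{(2S-1) ∪ 2S}: a pair (v_{2i-1}, v_{2i}) for every i ∈ S.
VS : (m : ℕ) → {c : ℕ} → Subset c → Set
VS m []           = ⊤
VS m (true  ∷ S)  = (Fin m × Fin m) × VS m S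
VS m (false ∷ S)  = VS m S

allVS : (m : ℕ) → {c : ℕ} → (S : Subset c) → List (VS m S)
allVS m []          = tt ∷ []
allVS m (true  ∷ S) = concatMap (λ ab → map (ab ,_) (allVS m S))
                        (concatMap (λ a → map (a ,_) (allFin m)) (allFin m))
allVS m (false ∷ S) = allVS m S

-- The event "∀ i ∈ S : G_{2i}(v_{2i-1}) = v_{2i}" for Alice's input x.
event : {m c : ℕ} → (S : Subset c) → VS m S → AliceInput m c → Bool
event []          tt              []      = true
event (true  ∷ S) ((a , b) , v)  (σ ∷ x) = ⌊ lookup σ a ≟ b ⌋ Data.Bool.∧ event S v x
event (false ∷ S) v              (σ ∷ x) = event S v x

-- Messages: bit strings. A protocol message of at most C bits is a function
-- msg from Alice's input to List Bool with length ≤ C.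
Message : Set
Message = List Bool

eqMsg : Message → Message → Bool
eqMsg xs ys = ⌊ Data.List.Properties.≡-dec Data.Bool._≟_ xs ys ⌋
  where import Data.List.Properties

-- p_S(v_S | Π = π) = Pr[event | Π = π]
pS : {m c : ℕ} → (AliceInput m c → Message) → (S : Subset c) → VS m S → Message → ℚ
pS {m} {c} msg S v π =
  ratio (count (λ x → eqMsg (msg x) π Data.Bool.∧ event S v x) (allInputs m c))
        (count (λ x → eqMsg (msg x) π) (allInputs m c))

-- E_Π [ Σ_{v_S} p_S(v_S | Π)^2 ], the expectation over the uniformly random
-- input X of Alice, with Π = msg X.
expectedCollision : {m c : ℕ} → (AliceInput m c → Message) → Subset c → ℚ
expectedCollision {m} {c} msg S =
  ratio 1 (length (allInputs m c)) *
  sumℚ (map (λ x → sumℚ (map (λ v → pS msg S v (msg x) ^ℚ 2) (allVS m S)))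
            (allInputs m c))

-- Γ(m,C) = 4 √(2 (C + log₂ m) m) is irrational in general; we express
-- statements about it through exact integer reformulations.

-- "Γ(m,C) < m/4".  For m ≥ 1:  Γ < m/4  ⇔  32 m (C + log m) < m²/16
--   ⇔  512 (C + log m) < m  ⇔  2^(512 C) · m^512 < 2^m.
GammaLtQuarter : ℕ → ℕ → Set
GammaLtQuarter m C = 2 ℕ.^ (512 ℕ.* C) ℕ.* m ℕ.^ 512 ℕ.< 2 ℕ.^ m

-- "Γ(m,C) ≤ p/q" (q ≥ 1):  (p/q)² ≥ 32 m (C + log m)
--   ⇔  p² / (32 m q²) ≥ C + log m  ⇔  2^(p²) ≥ (2^C · m)^(32 m q²).
GammaLe : ℕ → ℕ → ℕ → ℕ → Set
GammaLe m C p q = (2 ℕ.^ C ℕ.* m) ℕ.^ (32 ℕ.* m ℕ.* (q ℕ.* q)) ℕ.≤ 2 ℕ.^ (p ℕ.* p)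

{-# OPTIONS --safe #-}
-- Fix a message π sent by n inputs.  Then Σ_v p_S(v | π)² = W / n², where W counts the
-- triples (y, z, v) with y and z sending π and both satisfying the event at v; for fixed y, z
-- the number of such v is the product over i ∈ S of the number of positions at which the
-- matchings y_i and z_i agree.  Against a uniformly random matching this number has k-th
-- moment at most k^k, as the number of fixed points of a random permutation does.  With
-- t^C F ≤ t^(C+1) + F^(C+1) this gives t^C W ≤ t^(C+1) n² + n (k^k)^|S| N for k = C + 1 and N
-- the number of inputs, and since fewer than 2^(C+1) messages occur, the expectation is at most
-- t + 2^(C+1) (k^k)^|S| / t^C.  For S ≠ ∅ and t = (2k)^|S| this is at most 2t ≤ (4(C+1))^|S|
-- (for S = ∅ it is at most 1), a bound independent of m; the hypotheses on Γ only serve to show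
-- Γ ≥ 4C.
module Submission where

open import Algebra.Bundles using (CommutativeSemiring; CommutativeRing)
open import Data.Bool using (Bool; true; false; _∧_)
open import Data.Empty using (⊥-elim)
open import Data.Fin using (Fin; _≟_)
open import Data.Fin.Permutation using (Permutation; _⟨$⟩ʳ_; _⟨$⟩ˡ_; inverseˡ; inverseʳ)
open import Data.Fin.Subset using (Subset; ∣_∣)
open import Data.List using (List; []; _∷_; _++_; map; foldr; concatMap; filter; length)
import Data.List.Properties as List
open import Data.List.Membership.Propositional using (_∈_)
open import Data.List.Membership.Propositional.Properties using (∈-allFin)
open import Data.List.Relation.Unary.All as All using (All; []; _∷_)
open import Data.List.Relation.Unary.Any using (here; there)
open import Data.List.Relation.Unary.Unique.Propositional using (Unique; []; _∷_)
open import Data.List.Relation.Unary.Unique.Propositional.Properties using (allFin⁺)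
open import Data.Nat using (ℕ; zero; suc)
open import Data.Product using (_×_; _,_)
open import Data.Vec as Vec using (Vec; []; _∷_; toList; lookup)
open import Function using (_∘_; _⇔_; mk⇔)
open import Relation.Binary.Core using (Rel; _Preserves₂_⟶_⟶_)
open import Relation.Binary.Definitions using (Reflexive; DecidableEquality)
open import Relation.Binary.PropositionalEquality as ≡ using (_≡_; _≢_)
open import Relation.Nullary using (Dec; does; yes; no; ¬_)
open import Relation.Nullary.Decidable using (⌊_⌋; does-⇔; isYes≗does)

open import Defs

module FiniteSum {c ℓ} (R : CommutativeSemiring c ℓ) where

  open CommutativeSemiring R
  open import Relation.Binary.Reasoning.Setoid setoid
  open import Algebra.Properties.CommutativeSemigroup +-commutativeSemigroup using (interchange)

  ∑ : {A : Set} → List A → (A → Carrier) → Carrier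
  ∑ xs f = foldr _+_ 0# (map f xs)

  syntax ∑ xs (λ x → e) = ∑[ x ∈ xs ] e

  𝟙 : Bool → Carrier
  𝟙 true  = 1#
  𝟙 false = 0#

  𝟙-⇔ : ∀ {P Q : Set} → P ⇔ Q → (P? : Dec P) (Q? : Dec Q) → 𝟙 ⌊ P? ⌋ ≡ 𝟙 ⌊ Q? ⌋
  𝟙-⇔ P⇔Q P? Q? = ≡.cong 𝟙 (≡.trans (isYes≗does P?) (≡.trans (does-⇔ P⇔Q P? Q?) (≡.sym (isYes≗does Q?))))

  module _ {A : Set} where

    ∑-cong : ∀ (xs : List A) {f g : A → Carrier} → (∀ x → f x ≈ g x) → ∑ xs f ≈ ∑ xs g
    ∑-cong []       f≈g = refl
    ∑-cong (x ∷ xs) f≈g = +-cong (f≈g x) (∑-cong xs f≈g)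

    ∑-zero : ∀ (xs : List A) → ∑[ x ∈ xs ] 0# ≈ 0#
    ∑-zero []       = refl
    ∑-zero (x ∷ xs) = trans (+-identityˡ _) (∑-zero xs)

    ∑-++ : ∀ (xs ys : List A) (f : A → Carrier) → ∑ (xs ++ ys) f ≈ ∑ xs f + ∑ ys f
    ∑-++ []       ys f = sym (+-identityˡ _)
    ∑-++ (x ∷ xs) ys f = trans (+-congˡ (∑-++ xs ys f)) (sym (+-assoc _ _ _))

    ∑-+ : ∀ (xs : List A) (f g : A → Carrier) → ∑[ x ∈ xs ] (f x + g x) ≈ ∑ xs f + ∑ xs g
    ∑-+ []       f g = sym (+-identityˡ _)
    ∑-+ (x ∷ xs) f g = trans (+-congˡ (∑-+ xs f g)) (interchange _ _ _ _)

    ∑-*ˡ : ∀ (xs : List A) (a : Carrier) (f : A → Carrier) → ∑[ x ∈ xs ] (a * f x) ≈ a * ∑ xs f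
    ∑-*ˡ []       a f = sym (zeroʳ a)
    ∑-*ˡ (x ∷ xs) a f = trans (+-congˡ (∑-*ˡ xs a f)) (sym (distribˡ a _ _))

    ∑-*ʳ : ∀ (xs : List A) (a : Carrier) (f : A → Carrier) → ∑[ x ∈ xs ] (f x * a) ≈ ∑ xs f * a
    ∑-*ʳ []       a f = sym (zeroˡ a)
    ∑-*ʳ (x ∷ xs) a f = trans (+-congˡ (∑-*ʳ xs a f)) (sym (distribʳ a _ _))

    ∑-filter : ∀ {P : A → Set} (P? : ∀ x → Dec (P x)) (xs : List A) (f : A → Carrier) →
               ∑ (filter P? xs) f ≈ ∑[ x ∈ xs ] (𝟙 (does (P? x)) * f x)
    ∑-filter P? []       f = refl
    ∑-filter P? (x ∷ xs) f with does (P? x)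
    ... | true  = +-cong (sym (*-identityˡ _)) (∑-filter P? xs f)
    ... | false = trans (∑-filter P? xs f) (sym (trans (+-congʳ (zeroˡ _)) (+-identityˡ _)))

    ∑-𝟙-≟ : (_≟_ : DecidableEquality A) {xs : List A} → Unique xs → ∀ {a} → a ∈ xs →
            (f : A → Carrier) → ∑[ x ∈ xs ] (𝟙 ⌊ a ≟ x ⌋ * f x) ≈ f a
    ∑-𝟙-≟ _≟_ {a ∷ xs} (a∉xs ∷ _) (here ≡.refl) f with a ≟ a
    ... | yes _   = trans (+-cong (*-identityˡ (f a)) (∑-𝟙-≟-absent a∉xs)) (+-identityʳ (f a))
      where
      ∑-𝟙-≟-absent : ∀ {ys} → All (a ≢_) ys → ∑[ y ∈ ys ] (𝟙 ⌊ a ≟ y ⌋ * f y) ≈ 0#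
      ∑-𝟙-≟-absent []             = refl
      ∑-𝟙-≟-absent {y ∷ _} (a≢y ∷ a∉ys) with a ≟ y
      ... | yes a≡y = ⊥-elim (a≢y a≡y)
      ... | no _    = trans (+-cong (zeroˡ (f y)) (∑-𝟙-≟-absent a∉ys)) (+-identityʳ 0#)
    ... | no a≢a = ⊥-elim (a≢a ≡.refl)
    ∑-𝟙-≟ _≟_ {y ∷ xs} (y∉xs ∷ xs!) {a} (there a∈xs) f with a ≟ y
    ... | yes ≡.refl = ⊥-elim (All.lookup y∉xs a∈xs ≡.refl)
    ... | no _       = trans (+-cong (zeroˡ (f y)) (∑-𝟙-≟ _≟_ xs! a∈xs f)) (+-identityˡ (f a))

  ∑-map : ∀ {A B : Set} (g : A → B) (xs : List A) (f : B → Carrier) → ∑ (map g xs) f ≡ ∑[ x ∈ xs ] f (g x)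
  ∑-map g xs f = ≡.cong (foldr _+_ 0#) (≡.sym (List.map-∘ xs))

  ∑-concatMap : ∀ {A B : Set} (g : A → List B) (xs : List A) (f : B → Carrier) →
                ∑ (concatMap g xs) f ≈ ∑[ x ∈ xs ] ∑ (g x) f
  ∑-concatMap g []       f = refl
  ∑-concatMap g (x ∷ xs) f = trans (∑-++ (g x) (concatMap g xs) f) (+-congˡ (∑-concatMap g xs f))

  module _ {A B : Set} where

    ∑-comm : ∀ (xs : List A) (ys : List B) (f : A → B → Carrier) →
             ∑[ x ∈ xs ] ∑[ y ∈ ys ] f x y ≈ ∑[ y ∈ ys ] ∑[ x ∈ xs ] f x y
    ∑-comm []       ys f = sym (∑-zero ys)
    ∑-comm (x ∷ xs) ys f = trans (+-congˡ (∑-comm xs ys f)) (sym (∑-+ ys (f x) _))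

    ∑-*-∑ : ∀ (xs : List A) (ys : List B) (f : A → Carrier) (g : B → Carrier) →
            ∑[ x ∈ xs ] ∑[ y ∈ ys ] (f x * g y) ≈ ∑ xs f * ∑ ys g
    ∑-*-∑ xs ys f g = trans (∑-cong xs (λ x → ∑-*ˡ ys (f x) g)) (∑-*ʳ xs (∑ ys g) f)

    ∑-cartesianProduct : ∀ (xs : List A) (ys : List B) (f : A × B → Carrier) →
                         ∑ (concatMap (λ x → map (x ,_) ys) xs) f ≈ ∑[ x ∈ xs ] ∑[ y ∈ ys ] f (x , y)
    ∑-cartesianProduct xs ys f = trans (∑-concatMap _ xs f) (∑-cong xs (λ x → reflexive (∑-map (x ,_) ys f)))

  module _ {A : Set} where

    ∑-allVecs-suc : ∀ (xs : List A) k (f : Vec A (suc k) → Carrier) →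
                    ∑ (allVecs xs (suc k)) f ≈ ∑[ x ∈ xs ] ∑[ v ∈ allVecs xs k ] f (x ∷ v)
    ∑-allVecs-suc xs k f =
      trans (∑-concatMap _ xs f) (∑-cong xs (λ x → reflexive (∑-map (x ∷_) (allVecs xs k) f)))

    ∑-allVecs-map : ∀ (g : A → A) (xs : List A) → (∀ h → ∑[ x ∈ xs ] h (g x) ≈ ∑ xs h) →
                    ∀ k (f : Vec A k → Carrier) → ∑[ v ∈ allVecs xs k ] f (Vec.map g v) ≈ ∑ (allVecs xs k) f
    ∑-allVecs-map g xs g-invariant zero    f = refl
    ∑-allVecs-map g xs g-invariant (suc k) f = begin
        ∑[ v ∈ allVecs xs (suc k) ] f (Vec.map g v)
      ≈⟨ ∑-allVecs-suc xs k _ ⟩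
        ∑[ x ∈ xs ] ∑[ v ∈ allVecs xs k ] f (g x ∷ Vec.map g v)
      ≈⟨ ∑-cong xs (λ x → ∑-allVecs-map g xs g-invariant k (λ v → f (g x ∷ v))) ⟩
        ∑[ x ∈ xs ] ∑[ v ∈ allVecs xs k ] f (g x ∷ v)
      ≈⟨ g-invariant (λ y → ∑[ v ∈ allVecs xs k ] f (y ∷ v)) ⟩
        ∑[ x ∈ xs ] ∑[ v ∈ allVecs xs k ] f (x ∷ v)
      ≈⟨ ∑-allVecs-suc xs k f ⟨
        ∑ (allVecs xs (suc k)) f ∎

  ∑-permute : ∀ {m} (π : Permutation m m) (f : Fin m → Carrier) →
              ∑[ a ∈ allFin m ] f (π ⟨$⟩ʳ a) ≈ ∑ (allFin m) f
  ∑-permute {m} π f = begin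
      ∑[ a ∈ allFin m ] f (π ⟨$⟩ʳ a)
    ≈⟨ ∑-cong (allFin m) (λ a → ∑-𝟙-≟ _≟_ (allFin⁺ m) (∈-allFin (π ⟨$⟩ʳ a)) f) ⟨
      ∑[ a ∈ allFin m ] ∑[ b ∈ allFin m ] (𝟙 ⌊ π ⟨$⟩ʳ a ≟ b ⌋ * f b)
    ≈⟨ ∑-comm (allFin m) (allFin m) _ ⟩
      ∑[ b ∈ allFin m ] ∑[ a ∈ allFin m ] (𝟙 ⌊ π ⟨$⟩ʳ a ≟ b ⌋ * f b)
    ≈⟨ ∑-cong (allFin m) (λ b → ∑-cong (allFin m) (λ a →
         *-congʳ (reflexive (𝟙-⇔ (moved a b) (π ⟨$⟩ʳ a ≟ b) (π ⟨$⟩ˡ b ≟ a))))) ⟩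
      ∑[ b ∈ allFin m ] ∑[ a ∈ allFin m ] (𝟙 ⌊ π ⟨$⟩ˡ b ≟ a ⌋ * f b)
    ≈⟨ ∑-cong (allFin m) (λ b → ∑-𝟙-≟ _≟_ (allFin⁺ m) (∈-allFin (π ⟨$⟩ˡ b)) (λ _ → f b)) ⟩
      ∑ (allFin m) f ∎
    where
    moved : ∀ a b → (π ⟨$⟩ʳ a ≡ b) ⇔ (π ⟨$⟩ˡ b ≡ a)
    moved a b = mk⇔ (λ πa≡b → ≡.trans (≡.cong (π ⟨$⟩ˡ_) (≡.sym πa≡b)) (inverseˡ π))
                    (λ π⁻¹b≡a → ≡.trans (≡.cong (π ⟨$⟩ʳ_) (≡.sym π⁻¹b≡a)) (inverseʳ π))

  module Monotone {ℓ′} {_≤_ : Rel Carrier ℓ′} (≤-refl : Reflexive _≤_)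
                  (+-mono-≤ : _+_ Preserves₂ _≤_ ⟶ _≤_ ⟶ _≤_) {A : Set} where

    ∑-mono-∈ : ∀ (xs : List A) {f g : A → Carrier} → (∀ x → x ∈ xs → f x ≤ g x) → ∑ xs f ≤ ∑ xs g
    ∑-mono-∈ []       f≤g = ≤-refl
    ∑-mono-∈ (x ∷ xs) f≤g = +-mono-≤ (f≤g x (here ≡.refl)) (∑-mono-∈ xs (λ y → f≤g y ∘ there))

    ∑-mono : ∀ (xs : List A) {f g : A → Carrier} → (∀ x → f x ≤ g x) → ∑ xs f ≤ ∑ xs g
    ∑-mono xs f≤g = ∑-mono-∈ xs (λ x _ → f≤g x)

module Arithmetic where

  open import Data.Nat using (_+_; _*_; _^_; _≤_; _<_; _≤?_; _<?_; z≤n; s≤s; NonZero)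
  open import Data.Nat.Properties
  open import Algebra.Properties.CommutativeSemigroup *-commutativeSemigroup using (interchange)
  open import Relation.Binary.PropositionalEquality using (refl; cong; trans)
  open import Relation.Nullary.Negation using (contradiction)

  *-^ : ∀ a b k → (a * b) ^ k ≡ a ^ k * b ^ k
  *-^ a b zero    = refl
  *-^ a b (suc k) = trans (cong ((a * b) *_) (*-^ a b k)) (interchange a b (a ^ k) (b ^ k))

  -- t ^ k * f ≤ max t f ^ suc k
  ^*≤^+^ : ∀ t f k → t ^ k * f ≤ t ^ suc k + f ^ suc k
  ^*≤^+^ t f k with f ≤? t
  ... | yes f≤t = begin
      t ^ k * f        ≤⟨ *-monoʳ-≤ (t ^ k) f≤t ⟩
      t ^ k * t        ≡⟨ *-comm (t ^ k) t ⟩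
      t ^ suc k        ≤⟨ m≤m+n (t ^ suc k) (f ^ suc k) ⟩
      t ^ suc k + f ^ suc k ∎
    where open ≤-Reasoning
  ... | no f≰t = begin
      t ^ k * f        ≤⟨ *-monoˡ-≤ f (^-monoˡ-≤ k (<⇒≤ (≰⇒> f≰t))) ⟩
      f ^ k * f        ≡⟨ *-comm (f ^ k) f ⟩
      f ^ suc k        ≤⟨ m≤n+m (f ^ suc k) (t ^ suc k) ⟩
      t ^ suc k + f ^ suc k ∎
    where open ≤-Reasoning

  2^-reflects-≤ : ∀ {a b} → 2 ^ a ≤ 2 ^ b → a ≤ b
  2^-reflects-≤ {a} {b} 2^a≤2^b with a ≤? b
  ... | yes a≤b = a≤b
  ... | no a≰b  = contradiction 2^a≤2^b (<⇒≱ (^-monoʳ-< 2 (s≤s (s≤s z≤n)) (≰⇒> a≰b)))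

  2^-reflects-< : ∀ {a b} → 2 ^ a < 2 ^ b → a < b
  2^-reflects-< {a} {b} 2^a<2^b with a <? b
  ... | yes a<b = a<b
  ... | no a≮b  = contradiction (^-monoʳ-≤ 2 (≮⇒≥ a≮b)) (<⇒≱ 2^a<2^b)

  square-reflects-≤ : ∀ {a b} → a * a ≤ b * b → a ≤ b
  square-reflects-≤ {a} {b} a²≤b² with a ≤? b
  ... | yes a≤b = a≤b
  ... | no a≰b  = contradiction a²≤b² (<⇒≱ (*-mono-< (≰⇒> a≰b) (≰⇒> a≰b)))

  collision-budget : ∀ k s .{{_ : NonZero s}} → (k ^ k) ^ s * 2 ^ k ≤ ((2 * k) ^ s) ^ k
  collision-budget k s@(suc s′) = begin
      (k ^ k) ^ s * 2 ^ k
    ≤⟨ *-monoʳ-≤ ((k ^ k) ^ s) (m≤m*n (2 ^ k) ((2 ^ k) ^ s′) {{m^n≢0 (2 ^ k) s′ {{m^n≢0 2 k}}}}) ⟩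
      (k ^ k) ^ s * (2 ^ k) ^ s
    ≡⟨ trans (*-^ (2 ^ k) (k ^ k) s) (*-comm ((2 ^ k) ^ s) ((k ^ k) ^ s)) ⟨
      (2 ^ k * k ^ k) ^ s
    ≡⟨ cong (_^ s) (*-^ 2 k k) ⟨
      ((2 * k) ^ k) ^ s
    ≡⟨ trans (^-*-assoc (2 * k) k s) (cong ((2 * k) ^_) (*-comm k s)) ⟩
      (2 * k) ^ (s * k)
    ≡⟨ ^-*-assoc (2 * k) s k ⟨
      ((2 * k) ^ s) ^ k ∎
    where open ≤-Reasoning

  double≤ : ∀ k s .{{_ : NonZero s}} → (2 * k) ^ s + (2 * k) ^ s ≤ (4 * k) ^ s
  double≤ k s@(suc s′) = begin
      (2 * k) ^ s + (2 * k) ^ s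
    ≡⟨ cong ((2 * k) ^ s +_) (+-identityʳ _) ⟨
      2 * (2 * k) ^ s
    ≤⟨ *-monoˡ-≤ ((2 * k) ^ s) (*-monoʳ-≤ 2 (m^n>0 2 s′)) ⟩
      2 ^ s * (2 * k) ^ s
    ≡⟨ *-^ 2 (2 * k) s ⟨
      (2 * (2 * k)) ^ s
    ≡⟨ cong (_^ s) (*-assoc 2 2 k) ⟨
      (4 * k) ^ s ∎
    where open ≤-Reasoning

module NatSum where

  open import Data.Nat using (_+_; _*_; _^_; _≤_; z≤n; s≤s)
  open import Data.Nat.Properties
  open import Data.Nat.ListAction using (product)
  open import Data.Bool.Properties using (T?)
  import Data.List.Membership.DecPropositional as DecMembership
  open import Relation.Binary.PropositionalEquality using (refl; cong; sym; trans; module ≡-Reasoning)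

  open import Algebra.Properties.CommutativeSemigroup *-commutativeSemigroup using (x∙yz≈y∙xz)
  open FiniteSum +-*-commutativeSemiring public
  open Monotone {_≤_ = _≤_} ≤-refl +-mono-≤ public
  open Arithmetic using (^*≤^+^)

  𝟙≤1 : ∀ b → 𝟙 b ≤ 1
  𝟙≤1 true  = ≤-refl
  𝟙≤1 false = z≤n

  𝟙-∧ : ∀ a b → 𝟙 (a ∧ b) ≡ 𝟙 a * 𝟙 b
  𝟙-∧ true  b = sym (+-identityʳ (𝟙 b))
  𝟙-∧ false b = refl

  length≡∑1 : ∀ {A : Set} (xs : List A) → length xs ≡ ∑[ x ∈ xs ] 1
  length≡∑1 []       = refl
  length≡∑1 (x ∷ xs) = cong suc (length≡∑1 xs)

  module _ {A : Set} where

    ∑-const : ∀ (xs : List A) a → ∑[ x ∈ xs ] a ≡ length xs * a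
    ∑-const xs a = trans (∑-cong xs (λ _ → sym (*-identityˡ a)))
                         (trans (∑-*ʳ xs a (λ _ → 1)) (cong (_* a) (sym (length≡∑1 xs))))

    count≡∑ : ∀ (p : A → Bool) xs → count p xs ≡ ∑[ x ∈ xs ] 𝟙 (p x)
    count≡∑ p xs = trans (length≡∑1 (filter (T? ∘ p) xs))
                         (trans (∑-filter (T? ∘ p) xs (λ _ → 1)) (∑-cong xs (λ x → 𝟙-T? (p x))))
      where
      𝟙-T? : ∀ b → 𝟙 (does (T? b)) * 1 ≡ 𝟙 b
      𝟙-T? true  = refl
      𝟙-T? false = refl

    ∑-^ : ∀ (xs : List A) (f : A → ℕ) k →
          ∑ xs f ^ k ≡ ∑[ v ∈ allVecs xs k ] product (map f (toList v))
    ∑-^ xs f zero    = refl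
    ∑-^ xs f (suc k) = begin
        ∑ xs f * ∑ xs f ^ k
      ≡⟨ cong (∑ xs f *_) (∑-^ xs f k) ⟩
        ∑ xs f * ∑[ v ∈ allVecs xs k ] product (map f (toList v))
      ≡⟨ ∑-*ʳ xs _ f ⟨
        ∑[ x ∈ xs ] (f x * ∑[ v ∈ allVecs xs k ] product (map f (toList v)))
      ≡⟨ ∑-cong xs (λ x → ∑-*ˡ (allVecs xs k) (f x) _) ⟨
        ∑[ x ∈ xs ] ∑[ v ∈ allVecs xs k ] (f x * product (map f (toList v)))
      ≡⟨ ∑-allVecs-suc xs k _ ⟨
        ∑[ v ∈ allVecs xs (suc k) ] product (map f (toList v)) ∎
      where open ≡-Reasoning

    length-allVecs : ∀ (xs : List A) k → length (allVecs xs k) ≡ length xs ^ k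
    length-allVecs xs zero    = refl
    length-allVecs xs (suc k) = begin
        length (allVecs xs (suc k))
      ≡⟨ length≡∑1 (allVecs xs (suc k)) ⟩
        ∑ (allVecs xs (suc k)) (λ _ → 1)
      ≡⟨ ∑-allVecs-suc xs k _ ⟩
        ∑[ x ∈ xs ] ∑ (allVecs xs k) (λ _ → 1)
      ≡⟨ ∑-cong xs (λ _ → trans (sym (length≡∑1 (allVecs xs k))) (length-allVecs xs k)) ⟩
        ∑[ x ∈ xs ] (length xs ^ k)
      ≡⟨ ∑-const xs (length xs ^ k) ⟩
        length xs ^ suc k ∎
      where open ≡-Reasoning

    ∑-𝟙-injective≤1 : ∀ {B : Set} (_≟_ : DecidableEquality B) {f : A → B} →
                         (∀ {x y} → f x ≡ f y → x ≡ y) → ∀ {xs} → Unique xs → ∀ b →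
                         ∑[ x ∈ xs ] 𝟙 ⌊ f x ≟ b ⌋ ≤ 1
    ∑-𝟙-injective≤1 _≟_ f-inj []             b = z≤n
    ∑-𝟙-injective≤1 _≟_ {f} f-inj {x ∷ xs} (x∉xs ∷ xs!) b with f x ≟ b
    ... | yes fx≡b = s≤s (≤-trans (∑-mono-∈ xs others-miss) (≤-reflexive (∑-zero xs)))
      where
      others-miss : ∀ y → y ∈ xs → 𝟙 ⌊ f y ≟ b ⌋ ≤ 0
      others-miss y y∈xs with f y ≟ b
      ... | yes fy≡b = ⊥-elim (All.lookup x∉xs y∈xs (f-inj (trans fx≡b (sym fy≡b))))
      ... | no _     = z≤n
    ... | no _     = ∑-𝟙-injective≤1 _≟_ f-inj xs! b

  module _ {A : Set} (_≟_ : DecidableEquality A) where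

    open DecMembership _≟_ using (_∈?_)

    ∑-𝟙-∈?≤length : ∀ {xs} → Unique xs → ∀ D → ∑[ x ∈ xs ] 𝟙 ⌊ x ∈? D ⌋ ≤ length D
    ∑-𝟙-∈?≤length {xs} xs! D = begin
        ∑[ x ∈ xs ] 𝟙 ⌊ x ∈? D ⌋
      ≤⟨ ∑-mono xs (λ x → 𝟙-∈?≤ x D) ⟩
        ∑[ x ∈ xs ] ∑[ d ∈ D ] 𝟙 ⌊ x ≟ d ⌋
      ≡⟨ ∑-comm xs D _ ⟩
        ∑[ d ∈ D ] ∑[ x ∈ xs ] 𝟙 ⌊ x ≟ d ⌋
      ≤⟨ ∑-mono D (∑-𝟙-injective≤1 _≟_ (λ x≡y → x≡y) xs!) ⟩
        ∑[ d ∈ D ] 1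
      ≡⟨ length≡∑1 D ⟨
        length D ∎
      where
      open ≤-Reasoning
      𝟙-∈?≤ : ∀ x D → 𝟙 ⌊ x ∈? D ⌋ ≤ ∑[ d ∈ D ] 𝟙 ⌊ x ≟ d ⌋
      𝟙-∈?≤ x D with x ∈? D
      ... | yes x∈D = 1≤∑ x∈D
        where
        1≤∑ : ∀ {D} → x ∈ D → 1 ≤ ∑[ d ∈ D ] 𝟙 ⌊ x ≟ d ⌋
        1≤∑ (here refl) with x ≟ x
        ... | yes _   = s≤s z≤n
        ... | no x≢x = ⊥-elim (x≢x refl)
        1≤∑ (there x∈D) = ≤-trans (1≤∑ x∈D) (m≤n+m _ _)
      ... | no _    = z≤n

  ∑∑-weighted≤ : ∀ {A : Set} (xs : List A) (w : A → ℕ) (F : A → A → ℕ) t k B →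
                 (∀ x → w x ≤ 1) → (∀ x → x ∈ xs → ∑[ y ∈ xs ] (F x y ^ suc k) ≤ B) →
                 t ^ k * ∑[ x ∈ xs ] ∑[ y ∈ xs ] (w x * w y * F x y) ≤ t ^ suc k * (∑ xs w * ∑ xs w) + ∑ xs w * B
  ∑∑-weighted≤ xs w F t k B w≤1 moment = begin
      t ^ k * ∑[ x ∈ xs ] ∑[ y ∈ xs ] (w x * w y * F x y)
    ≡⟨ ∑-*ˡ xs (t ^ k) _ ⟨
      ∑[ x ∈ xs ] (t ^ k * ∑[ y ∈ xs ] (w x * w y * F x y))
    ≡⟨ ∑-cong xs (λ x → trans (∑-cong xs (λ y → x∙yz≈y∙xz (w x * w y) (t ^ k) (F x y))) (∑-*ˡ xs (t ^ k) _)) ⟨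
      ∑[ x ∈ xs ] ∑[ y ∈ xs ] (w x * w y * (t ^ k * F x y))
    ≤⟨ ∑-mono xs (λ x → ∑-mono xs (λ y → *-monoʳ-≤ (w x * w y) (^*≤^+^ t (F x y) k))) ⟩
      ∑[ x ∈ xs ] ∑[ y ∈ xs ] (w x * w y * (t ^ suc k + F x y ^ suc k))
    ≡⟨ ∑-cong xs (λ x → trans (∑-cong xs (λ y → *-distribˡ-+ (w x * w y) _ _)) (∑-+ xs _ _)) ⟩
      ∑[ x ∈ xs ] (∑[ y ∈ xs ] (w x * w y * t ^ suc k) + ∑[ y ∈ xs ] (w x * w y * F x y ^ suc k))
    ≡⟨ ∑-+ xs _ _ ⟩
      ∑[ x ∈ xs ] ∑[ y ∈ xs ] (w x * w y * t ^ suc k) + ∑[ x ∈ xs ] ∑[ y ∈ xs ] (w x * w y * F x y ^ suc k)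
    ≤⟨ +-mono-≤ (≤-reflexive squares) weighted-moments ⟩
      t ^ suc k * (∑ xs w * ∑ xs w) + ∑ xs w * B ∎
    where
    open ≤-Reasoning
    squares : ∑[ x ∈ xs ] ∑[ y ∈ xs ] (w x * w y * t ^ suc k) ≡ t ^ suc k * (∑ xs w * ∑ xs w)
    squares = begin-equality
        ∑[ x ∈ xs ] ∑[ y ∈ xs ] (w x * w y * t ^ suc k)
      ≡⟨ ∑-cong xs (λ x → ∑-*ʳ xs (t ^ suc k) (λ y → w x * w y)) ⟩
        ∑[ x ∈ xs ] (∑[ y ∈ xs ] (w x * w y) * t ^ suc k)
      ≡⟨ ∑-*ʳ xs (t ^ suc k) _ ⟩
        ∑[ x ∈ xs ] ∑[ y ∈ xs ] (w x * w y) * t ^ suc k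
      ≡⟨ cong (_* t ^ suc k) (∑-*-∑ xs xs w w) ⟩
        ∑ xs w * ∑ xs w * t ^ suc k
      ≡⟨ *-comm _ (t ^ suc k) ⟩
        t ^ suc k * (∑ xs w * ∑ xs w) ∎
    weighted-moments : ∑[ x ∈ xs ] ∑[ y ∈ xs ] (w x * w y * F x y ^ suc k) ≤ ∑ xs w * B
    weighted-moments = begin
        ∑[ x ∈ xs ] ∑[ y ∈ xs ] (w x * w y * F x y ^ suc k)
      ≡⟨ ∑-cong xs (λ x → trans (∑-cong xs (λ y → *-assoc (w x) (w y) _)) (∑-*ˡ xs (w x) _)) ⟩
        ∑[ x ∈ xs ] (w x * ∑[ y ∈ xs ] (w y * F x y ^ suc k))
      ≤⟨ ∑-mono-∈ xs (λ x x∈xs → *-monoʳ-≤ (w x) (≤-trans (∑-mono xs (λ y → *-monoˡ-≤ _ (w≤1 y)))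
                                                         (≤-trans (≤-reflexive (∑-cong xs (λ y → *-identityˡ _)))
                                                                  (moment x x∈xs)))) ⟩
        ∑[ x ∈ xs ] (w x * B)
      ≡⟨ ∑-*ʳ xs B w ⟩
        ∑ xs w * B ∎

module Matchings where

  open import Data.Nat using (_*_)
  open import Data.List.Membership.Propositional.Properties using (∈-filter⁻)
  import Data.List.Relation.Unary.Unique.Propositional.Properties as Unique
  import Data.List.Relation.Unary.Unique.DecPropositional as UniqueDec
  open import Data.Vec.Membership.Propositional.Properties using (∈-lookup; ∈-toList⁺)
  import Data.Vec.Properties as Vec
  open import Data.Product using (proj₂)
  open import Relation.Binary.PropositionalEquality using (refl; cong; sym; trans; subst; module ≡-Reasoning)
  open NatSum

  lookup-injective : ∀ {A : Set} {n} {σ : Vec A n} → Unique (toList σ) →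
                     ∀ {a b} → lookup σ a ≡ lookup σ b → a ≡ b
  lookup-injective {σ = x ∷ σ} (x∉σ ∷ σ!) {Fin.zero}  {Fin.zero}  _ = refl
  lookup-injective {σ = x ∷ σ} (x∉σ ∷ σ!) {Fin.zero}  {Fin.suc b} x≡σb =
    ⊥-elim (All.lookup x∉σ (∈-toList⁺ (∈-lookup b σ)) x≡σb)
  lookup-injective {σ = x ∷ σ} (x∉σ ∷ σ!) {Fin.suc a} {Fin.zero}  σa≡x =
    ⊥-elim (All.lookup x∉σ (∈-toList⁺ (∈-lookup a σ)) (sym σa≡x))
  lookup-injective {σ = x ∷ σ} (x∉σ ∷ σ!) {Fin.suc a} {Fin.suc b} σa≡σb =
    cong Fin.suc (lookup-injective σ! σa≡σb)

  ∈-allMatchings⁻ : ∀ {m} {σ : Matching m} → σ ∈ allMatchings m → Unique (toList σ)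
  ∈-allMatchings⁻ {m} = proj₂ ∘ ∈-filter⁻ (λ σ → unique? (toList σ)) {xs = allVecs (allFin m) m}
    where open UniqueDec (_≟_ {m}) using (unique?)

  ∑-allMatchings-permute : ∀ {m} (π : Permutation m m) (f : Matching m → ℕ) →
                           ∑[ τ ∈ allMatchings m ] f (Vec.map (π ⟨$⟩ʳ_) τ) ≡ ∑ (allMatchings m) f
  ∑-allMatchings-permute {m} π f = begin
      ∑[ τ ∈ allMatchings m ] f (πτ τ)
    ≡⟨ ∑-filter unique?ₜ Vs (f ∘ πτ) ⟩
      ∑[ τ ∈ Vs ] (𝟙 (does (unique?ₜ τ)) * f (πτ τ))
    ≡⟨ ∑-cong Vs (λ τ → cong (λ b → 𝟙 b * f (πτ τ))
                             (does-⇔ (unique-πτ τ) (unique?ₜ (πτ τ)) (unique?ₜ τ))) ⟨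
      ∑[ τ ∈ Vs ] (𝟙 (does (unique?ₜ (πτ τ))) * f (πτ τ))
    ≡⟨ ∑-allVecs-map (π ⟨$⟩ʳ_) (allFin m) (∑-permute π) m (λ τ → 𝟙 (does (unique?ₜ τ)) * f τ) ⟩
      ∑[ τ ∈ Vs ] (𝟙 (does (unique?ₜ τ)) * f τ)
    ≡⟨ ∑-filter unique?ₜ Vs f ⟨
      ∑ (allMatchings m) f ∎
    where
    open UniqueDec (_≟_ {m}) using (unique?)
    open ≡-Reasoning
    Vs : List (Matching m)
    Vs = allVecs (allFin m) m
    unique?ₜ : ∀ (τ : Matching m) → Dec (Unique (toList τ))
    unique?ₜ τ = unique? (toList τ)
    πτ : Matching m → Matching m
    πτ = Vec.map (π ⟨$⟩ʳ_)
    π-injective : ∀ {a b} → π ⟨$⟩ʳ a ≡ π ⟨$⟩ʳ b → a ≡ b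
    π-injective {a} {b} πa≡πb = trans (sym (inverseˡ π)) (trans (cong (π ⟨$⟩ˡ_) πa≡πb) (inverseˡ π))
    unique-πτ : ∀ τ → Unique (toList (πτ τ)) ⇔ Unique (toList τ)
    unique-πτ τ = mk⇔ (Unique.map⁻ ∘ subst Unique (Vec.toList-map _ τ))
                      (subst Unique (sym (Vec.toList-map _ τ)) ∘ Unique.map⁺ π-injective)

module Agreements {m : ℕ} where

  open import Data.Nat using (_+_; _*_; _^_; _≤_; z≤n; s≤s)
  open import Data.Nat.Properties hiding (_≟_)
  open import Data.Nat.ListAction using (product)
  open import Data.Nat.ListAction.Properties using (product-++)
  open import Data.Fin.Permutation using (transpose)
  open import Data.Fin.Properties using (any?)
  open import Algebra.Properties.CommutativeSemigroup *-commutativeSemigroup using (x∙yz≈y∙xz)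
  open import Data.List using (_∷ʳ_; [_])
  open import Data.List.Membership.DecPropositional (_≟_ {m}) using (_∈?_; _∉?_)
  open import Data.List.Membership.Propositional using (_∉_)
  import Data.Vec.Properties as Vec
  open import Data.Product using (_,_)
  open import Relation.Binary.PropositionalEquality using (refl; cong; cong₂; sym; trans; subst; module ≡-Reasoning)
  open import Relation.Nullary.Decidable using (dec-true; dec-false)
  open NatSum
  open Matchings

  agreements : Matching m → Matching m → ℕ
  agreements σ τ = ∑[ a ∈ allFin m ] 𝟙 ⌊ lookup τ a ≟ lookup σ a ⌋

  transpose-matchˡ : ∀ (i j : Fin m) → transpose i j ⟨$⟩ʳ i ≡ j
  transpose-matchˡ i j rewrite dec-true (i ≟ i) refl = refl

  transpose-fixes : ∀ {i j k : Fin m} → k ≢ i → k ≢ j → transpose i j ⟨$⟩ʳ k ≡ k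
  transpose-fixes {i} {j} {k} k≢i k≢j rewrite dec-false (k ≟ i) k≢i | dec-false (k ≟ j) k≢j = refl

  permute-≡-⇔ : ∀ (π : Permutation m m) {x x′ y} → π ⟨$⟩ʳ x ≡ x′ → (π ⟨$⟩ʳ y ≡ x′) ⇔ (y ≡ x)
  permute-≡-⇔ π {x} {x′} {y} πx≡x′ = mk⇔
    (λ πy≡x′ → trans (sym (inverseˡ π)) (trans (cong (π ⟨$⟩ˡ_) (trans πy≡x′ (sym πx≡x′))) (inverseˡ π)))
    (λ y≡x → trans (cong (π ⟨$⟩ʳ_) y≡x) πx≡x′)

  module Extensions (σ : Matching m) (σ-injective : ∀ {a b} → lookup σ a ≡ lookup σ b → a ≡ b) where

    P : List (Matching m)
    P = allMatchings m

    agreesAt : Matching m → Fin m → ℕ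
    agreesAt τ a = 𝟙 ⌊ lookup τ a ≟ lookup σ a ⌋

    agreesOn : List (Fin m) → Matching m → ℕ
    agreesOn D τ = product (map (agreesAt τ) D)

    extensions : List (Fin m) → ℕ
    extensions D = ∑[ τ ∈ P ] agreesOn D τ

    agreesOn-∷ʳ : ∀ D a τ → agreesOn (D ∷ʳ a) τ ≡ agreesOn D τ * agreesAt τ a
    agreesOn-∷ʳ D a τ = trans (cong product (List.map-++ (agreesAt τ) D [ a ]))
                              (trans (product-++ (map (agreesAt τ) D) _) (cong (agreesOn D τ *_) (*-identityʳ _)))

    extensions-∷ʳ≤ : ∀ D a → extensions (D ∷ʳ a) ≤ extensions D
    extensions-∷ʳ≤ D a = ∑-mono P (λ τ → begin
        agreesOn (D ∷ʳ a) τ        ≡⟨ agreesOn-∷ʳ D a τ ⟩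
        agreesOn D τ * agreesAt τ a ≤⟨ *-monoʳ-≤ (agreesOn D τ) (𝟙≤1 ⌊ lookup τ a ≟ lookup σ a ⌋) ⟩
        agreesOn D τ * 1            ≡⟨ *-identityʳ _ ⟩
        agreesOn D τ                ∎)
      where open ≤-Reasoning

    -- Post-composing with the transposition of σ a and σ a₀ permutes the matchings and fixes σ on D.
    extensions-∷ʳ-fresh : ∀ {D a a₀} → a ∉ D → a₀ ∉ D →
                          extensions (D ∷ʳ a) ≡ ∑[ τ ∈ P ] (agreesOn D τ * 𝟙 ⌊ lookup τ a ≟ lookup σ a₀ ⌋)
    extensions-∷ʳ-fresh {D} {a} {a₀} a∉D a₀∉D = begin
        extensions (D ∷ʳ a)
      ≡⟨ ∑-cong P (agreesOn-∷ʳ D a) ⟩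
        ∑[ τ ∈ P ] (agreesOn D τ * agreesAt τ a)
      ≡⟨ ∑-cong P (λ τ → cong₂ _*_ (agreesOn-π τ) (moved (transpose-matchˡ (lookup σ a) (lookup σ a₀)) τ a)) ⟨
        ∑[ τ ∈ P ] (agreesOn D (πτ τ) * 𝟙 ⌊ lookup (πτ τ) a ≟ lookup σ a₀ ⌋)
      ≡⟨ ∑-allMatchings-permute π (λ τ → agreesOn D τ * 𝟙 ⌊ lookup τ a ≟ lookup σ a₀ ⌋) ⟩
        ∑[ τ ∈ P ] (agreesOn D τ * 𝟙 ⌊ lookup τ a ≟ lookup σ a₀ ⌋) ∎
      where
      open ≡-Reasoning
      π : Permutation m m
      π = transpose (lookup σ a) (lookup σ a₀)
      πτ : Matching m → Matching m
      πτ = Vec.map (π ⟨$⟩ʳ_)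
      moved : ∀ {x x′} → π ⟨$⟩ʳ x ≡ x′ → ∀ τ i → 𝟙 ⌊ lookup (πτ τ) i ≟ x′ ⌋ ≡ 𝟙 ⌊ lookup τ i ≟ x ⌋
      moved {x} {x′} πx≡x′ τ i = trans (cong (λ b → 𝟙 ⌊ b ≟ x′ ⌋) (Vec.lookup-map i _ τ))
                                       (𝟙-⇔ (permute-≡-⇔ π πx≡x′) (π ⟨$⟩ʳ lookup τ i ≟ x′) (lookup τ i ≟ x))
      π-fixes-D : ∀ {d} → d ∈ D → π ⟨$⟩ʳ lookup σ d ≡ lookup σ d
      π-fixes-D d∈D = transpose-fixes (λ σd≡σa → a∉D (subst (_∈ D) (σ-injective σd≡σa) d∈D))
                                      (λ σd≡σa₀ → a₀∉D (subst (_∈ D) (σ-injective σd≡σa₀) d∈D))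
      agreesOn-π : ∀ τ → agreesOn D (πτ τ) ≡ agreesOn D τ
      agreesOn-π τ = cong product (List.map-cong-local (All.tabulate (λ d∈D → moved (π-fixes-D d∈D) τ _)))

    ∑-extensions-fresh≤ : ∀ D → ∑[ a ∈ allFin m ] (𝟙 ⌊ a ∉? D ⌋ * extensions (D ∷ʳ a)) ≤ extensions D
    ∑-extensions-fresh≤ D with any? (_∉? D)
    ... | no D-covers-all = begin
        ∑[ a ∈ allFin m ] (𝟙 ⌊ a ∉? D ⌋ * extensions (D ∷ʳ a))
      ≤⟨ ∑-mono (allFin m) no-fresh ⟩
        ∑[ a ∈ allFin m ] 0
      ≡⟨ ∑-zero (allFin m) ⟩
        0
      ≤⟨ z≤n ⟩
        extensions D ∎
      where
      open ≤-Reasoning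
      no-fresh : ∀ a → 𝟙 ⌊ a ∉? D ⌋ * extensions (D ∷ʳ a) ≤ 0
      no-fresh a with a ∉? D
      ... | yes a∉D = ⊥-elim (D-covers-all (a , a∉D))
      ... | no _    = z≤n
    ... | yes (a₀ , a₀∉D) = begin
        ∑[ a ∈ A ] (𝟙 ⌊ a ∉? D ⌋ * extensions (D ∷ʳ a))
      ≡⟨ ∑-cong A transposed ⟩
        ∑[ a ∈ A ] (𝟙 ⌊ a ∉? D ⌋ * ∑[ τ ∈ P ] (agreesOn D τ * hits τ a))
      ≡⟨ ∑-cong A (λ a → ∑-*ˡ P (𝟙 ⌊ a ∉? D ⌋) _) ⟨
        ∑[ a ∈ A ] ∑[ τ ∈ P ] (𝟙 ⌊ a ∉? D ⌋ * (agreesOn D τ * hits τ a))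
      ≡⟨ ∑-comm A P _ ⟩
        ∑[ τ ∈ P ] ∑[ a ∈ A ] (𝟙 ⌊ a ∉? D ⌋ * (agreesOn D τ * hits τ a))
      ≡⟨ ∑-cong P (λ τ → trans (∑-cong A (λ a → x∙yz≈y∙xz (𝟙 ⌊ a ∉? D ⌋) (agreesOn D τ) (hits τ a)))
                                (∑-*ˡ A (agreesOn D τ) _)) ⟩
        ∑[ τ ∈ P ] (agreesOn D τ * ∑[ a ∈ A ] (𝟙 ⌊ a ∉? D ⌋ * hits τ a))
      ≤⟨ ∑-mono-∈ P (λ τ τ∈P → *-monoʳ-≤ (agreesOn D τ) (at-most-one-hit τ (∈-allMatchings⁻ τ∈P))) ⟩
        ∑[ τ ∈ P ] (agreesOn D τ * 1)
      ≡⟨ ∑-cong P (λ τ → *-identityʳ _) ⟩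
        extensions D ∎
      where
      open ≤-Reasoning
      A = allFin m
      hits : Matching m → Fin m → ℕ
      hits τ a = 𝟙 ⌊ lookup τ a ≟ lookup σ a₀ ⌋
      transposed : ∀ a → 𝟙 ⌊ a ∉? D ⌋ * extensions (D ∷ʳ a)
                       ≡ 𝟙 ⌊ a ∉? D ⌋ * ∑[ τ ∈ P ] (agreesOn D τ * hits τ a)
      transposed a with a ∉? D
      ... | yes a∉D = cong (1 *_) (extensions-∷ʳ-fresh a∉D a₀∉D)
      ... | no _    = refl
      at-most-one-hit : ∀ τ → Unique (toList τ) → ∑[ a ∈ A ] (𝟙 ⌊ a ∉? D ⌋ * hits τ a) ≤ 1
      at-most-one-hit τ τ! = ≤-trans (∑-mono A (λ a → m*n≤n (𝟙≤1 ⌊ a ∉? D ⌋)))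
                                     (∑-𝟙-injective≤1 _≟_ (lookup-injective τ!) (allFin⁺ m) (lookup σ a₀))
        where
        m*n≤n : ∀ {i} {j} → i ≤ 1 → i * j ≤ j
        m*n≤n {j = j} i≤1 = ≤-trans (*-monoˡ-≤ j i≤1) (≤-reflexive (+-identityʳ j))

    ∑-extensions-∷ʳ≤ : ∀ D → ∑[ a ∈ allFin m ] extensions (D ∷ʳ a) ≤ suc (length D) * extensions D
    ∑-extensions-∷ʳ≤ D = begin
        ∑[ a ∈ A ] extensions (D ∷ʳ a)
      ≡⟨ ∑-cong A split ⟩
        ∑[ a ∈ A ] (𝟙 ⌊ a ∈? D ⌋ * extensions (D ∷ʳ a) + 𝟙 ⌊ a ∉? D ⌋ * extensions (D ∷ʳ a))
      ≡⟨ ∑-+ A _ _ ⟩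
        ∑[ a ∈ A ] (𝟙 ⌊ a ∈? D ⌋ * extensions (D ∷ʳ a)) + ∑[ a ∈ A ] (𝟙 ⌊ a ∉? D ⌋ * extensions (D ∷ʳ a))
      ≤⟨ +-mono-≤ (∑-mono A (λ a → *-monoʳ-≤ (𝟙 ⌊ a ∈? D ⌋) (extensions-∷ʳ≤ D a))) (∑-extensions-fresh≤ D) ⟩
        ∑[ a ∈ A ] (𝟙 ⌊ a ∈? D ⌋ * extensions D) + extensions D
      ≡⟨ cong (_+ extensions D) (∑-*ʳ A (extensions D) _) ⟩
        ∑[ a ∈ A ] 𝟙 ⌊ a ∈? D ⌋ * extensions D + extensions D
      ≤⟨ +-monoˡ-≤ (extensions D) (*-monoˡ-≤ (extensions D) (∑-𝟙-∈?≤length _≟_ (allFin⁺ m) D)) ⟩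
        length D * extensions D + extensions D
      ≡⟨ +-comm (length D * extensions D) (extensions D) ⟩
        suc (length D) * extensions D ∎
      where
      open ≤-Reasoning
      A = allFin m
      split : ∀ a → extensions (D ∷ʳ a)
                  ≡ 𝟙 ⌊ a ∈? D ⌋ * extensions (D ∷ʳ a) + 𝟙 ⌊ a ∉? D ⌋ * extensions (D ∷ʳ a)
      split a with a ∈? D
      ... | yes _ = sym (trans (+-identityʳ _) (+-identityʳ _))
      ... | no _  = sym (+-identityʳ _)

    ∑-extensions-++≤ : ∀ r D → ∑[ v ∈ allVecs (allFin m) r ] extensions (D ++ toList v) ≤ (length D + r) ^ r * extensions D
    ∑-extensions-++≤ zero    D = ≤-reflexive (cong (λ E → extensions E + 0) (List.++-identityʳ D))
    ∑-extensions-++≤ (suc r) D = begin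
        ∑[ v ∈ allVecs A (suc r) ] extensions (D ++ toList v)
      ≡⟨ ∑-allVecs-suc A r _ ⟩
        ∑[ a ∈ A ] ∑[ v ∈ allVecs A r ] extensions (D ++ a ∷ toList v)
      ≡⟨ ∑-cong A (λ a → ∑-cong (allVecs A r) (λ v → cong extensions (List.++-assoc D [ a ] (toList v)))) ⟨
        ∑[ a ∈ A ] ∑[ v ∈ allVecs A r ] extensions ((D ∷ʳ a) ++ toList v)
      ≤⟨ ∑-mono A (λ a → ∑-extensions-++≤ r (D ∷ʳ a)) ⟩
        ∑[ a ∈ A ] ((length (D ∷ʳ a) + r) ^ r * extensions (D ∷ʳ a))
      ≡⟨ ∑-cong A (λ a → cong (λ ℓ → ℓ ^ r * extensions (D ∷ʳ a)) (length-∷ʳ+ a)) ⟩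
        ∑[ a ∈ A ] (L ^ r * extensions (D ∷ʳ a))
      ≡⟨ ∑-*ˡ A (L ^ r) _ ⟩
        L ^ r * ∑[ a ∈ A ] extensions (D ∷ʳ a)
      ≤⟨ *-monoʳ-≤ (L ^ r) (∑-extensions-∷ʳ≤ D) ⟩
        L ^ r * (suc (length D) * extensions D)
      ≤⟨ *-monoʳ-≤ (L ^ r) (*-monoˡ-≤ (extensions D) (≤-trans (s≤s (m≤m+n (length D) r)) (≤-reflexive (sym (+-suc _ r))))) ⟩
        L ^ r * (L * extensions D)
      ≡⟨ x∙yz≈y∙xz (L ^ r) L (extensions D) ⟩
        L * (L ^ r * extensions D)
      ≡⟨ *-assoc L (L ^ r) (extensions D) ⟨
        L ^ suc r * extensions D ∎
      where
      open ≤-Reasoning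
      A = allFin m
      L = length D + suc r
      length-∷ʳ+ : ∀ a → length (D ∷ʳ a) + r ≡ L
      length-∷ʳ+ a = trans (cong (_+ r) (List.length-++ D)) (+-assoc (length D) 1 r)

  agreements-moment : ∀ {σ : Matching m} → Unique (toList σ) → ∀ k →
                      ∑[ τ ∈ allMatchings m ] (agreements σ τ ^ k) ≤ k ^ k * length (allMatchings m)
  agreements-moment {σ} σ! k = begin
      ∑[ τ ∈ P ] (agreements σ τ ^ k)
    ≡⟨ ∑-cong P (λ τ → ∑-^ (allFin m) (agreesAt τ) k) ⟩
      ∑[ τ ∈ P ] ∑[ v ∈ allVecs (allFin m) k ] agreesOn (toList v) τ
    ≡⟨ ∑-comm P (allVecs (allFin m) k) _ ⟩
      ∑[ v ∈ allVecs (allFin m) k ] extensions ([] ++ toList v)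
    ≤⟨ ∑-extensions-++≤ k [] ⟩
      k ^ k * extensions []
    ≡⟨ cong (k ^ k *_) (length≡∑1 P) ⟨
      k ^ k * length P ∎
    where
    open Extensions σ (lookup-injective σ!)
    open ≤-Reasoning

module Events where

  open import Data.Nat using (_+_; _*_; _^_; _≤_)
  open import Data.Nat.Properties hiding (_≟_)
  open import Algebra.Properties.CommutativeSemigroup *-commutativeSemigroup using (interchange; x∙yz≈y∙xz)
  open import Data.List.Membership.Propositional using (find)
  open import Data.List.Membership.Propositional.Properties using (∈-concatMap⁻; ∈-map⁻)
  open import Data.Product using (_×_; _,_; proj₁; proj₂)
  open import Relation.Binary.PropositionalEquality using (refl; cong; cong₂; trans; module ≡-Reasoning)
  open NatSum
  open Arithmetic using (*-^)
  open Matchings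
  open Agreements

  ∈-allVecs-∷⁻ : ∀ {A : Set} {xs : List A} {k x} {v : Vec A k} →
                 (x ∷ v) ∈ allVecs xs (suc k) → x ∈ xs × v ∈ allVecs xs k
  ∈-allVecs-∷⁻ {xs = xs} x∷v∈ with find (∈-concatMap⁻ _ {xs = xs} x∷v∈)
  ... | x′ , x′∈xs , x∷v∈x′∷vs with ∈-map⁻ (x′ ∷_) x∷v∈x′∷vs
  ... | v′ , v′∈vs , refl = x′∈xs , v′∈vs

  jointEvents : ∀ {m c} → Subset c → AliceInput m c → AliceInput m c → ℕ
  jointEvents {m} S y z = ∑[ v ∈ allVS m S ] (𝟙 (event S v y) * 𝟙 (event S v z))

  jointEvents-∷ : ∀ {m c} (S : Subset c) σ τ (y z : AliceInput m c) →
                  jointEvents (true ∷ S) (σ ∷ y) (τ ∷ z) ≡ agreements σ τ * jointEvents S y z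
  jointEvents-∷ {m} S σ τ y z = begin
      jointEvents (true ∷ S) (σ ∷ y) (τ ∷ z)
    ≡⟨ ∑-cartesianProduct (concatMap (λ a → map (a ,_) A) A) V _ ⟩
      ∑[ ab ∈ concatMap (λ a → map (a ,_) A) A ] ∑[ v ∈ V ] both ab v
    ≡⟨ ∑-cartesianProduct A A _ ⟩
      ∑[ a ∈ A ] ∑[ b ∈ A ] ∑[ v ∈ V ] both (a , b) v
    ≡⟨ ∑-cong A (λ a → ∑-cong A (λ b → trans (∑-cong V (separate a b)) (∑-*ˡ V (σ↦ a b * τ↦ a b) _))) ⟩
      ∑[ a ∈ A ] ∑[ b ∈ A ] (σ↦ a b * τ↦ a b * J)
    ≡⟨ ∑-cong A (λ a → trans (∑-*ʳ A J _) (cong (_* J) (∑-𝟙-≟ _≟_ (allFin⁺ m) (∈-allFin (lookup σ a)) (τ↦ a)))) ⟩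
      ∑[ a ∈ A ] (𝟙 ⌊ lookup τ a ≟ lookup σ a ⌋ * J)
    ≡⟨ ∑-*ʳ A J _ ⟩
      agreements σ τ * J ∎
    where
    open ≡-Reasoning
    A = allFin m
    V = allVS m S
    J = jointEvents S y z
    σ↦ τ↦ : Fin m → Fin m → ℕ
    σ↦ a b = 𝟙 ⌊ lookup σ a ≟ b ⌋
    τ↦ a b = 𝟙 ⌊ lookup τ a ≟ b ⌋
    both : Fin m × Fin m → VS m S → ℕ
    both (a , b) v = 𝟙 (⌊ lookup σ a ≟ b ⌋ ∧ event S v y) * 𝟙 (⌊ lookup τ a ≟ b ⌋ ∧ event S v z)
    separate : ∀ a b v → both (a , b) v ≡ σ↦ a b * τ↦ a b * (𝟙 (event S v y) * 𝟙 (event S v z))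
    separate a b v = trans (cong₂ _*_ (𝟙-∧ ⌊ lookup σ a ≟ b ⌋ (event S v y)) (𝟙-∧ ⌊ lookup τ a ≟ b ⌋ (event S v z)))
                           (interchange (σ↦ a b) (𝟙 (event S v y)) (τ↦ a b) (𝟙 (event S v z)))

  jointEvents-∅ : ∀ {m c} (S : Subset c) (y z : AliceInput m c) → ∣ S ∣ ≡ 0 → jointEvents S y z ≡ 1
  jointEvents-∅ []            []       []       _     = refl
  jointEvents-∅ (true ∷ S)  _            _            ()
  jointEvents-∅ (false ∷ S) (_ ∷ y) (_ ∷ z) ∣S∣≡0 = jointEvents-∅ S y z ∣S∣≡0

  ∑-jointEvents^≤ : ∀ {m c} (S : Subset c) {y : AliceInput m c} → y ∈ allInputs m c → ∀ k →
                    ∑[ z ∈ allInputs m c ] (jointEvents S y z ^ k) ≤ (k ^ k) ^ ∣ S ∣ * length (allMatchings m) ^ c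
  ∑-jointEvents^≤ [] {[]} _ k = ≤-reflexive (cong (_+ 0) (^-zeroˡ k))
  ∑-jointEvents^≤ {m} {suc c} (true ∷ S) {σ ∷ y} σ∷y∈ k = begin
      ∑[ z ∈ allInputs m (suc c) ] (jointEvents (true ∷ S) (σ ∷ y) z ^ k)
    ≡⟨ ∑-allVecs-suc P c _ ⟩
      ∑[ τ ∈ P ] ∑[ z ∈ allInputs m c ] (jointEvents (true ∷ S) (σ ∷ y) (τ ∷ z) ^ k)
    ≡⟨ ∑-cong P (λ τ → ∑-cong (allInputs m c) (λ z → trans (cong (_^ k) (jointEvents-∷ S σ τ y z))
                                                         (*-^ (agreements σ τ) (jointEvents S y z) k))) ⟩
      ∑[ τ ∈ P ] ∑[ z ∈ allInputs m c ] (agreements σ τ ^ k * jointEvents S y z ^ k)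
    ≡⟨ ∑-*-∑ P (allInputs m c) _ _ ⟩
      ∑[ τ ∈ P ] (agreements σ τ ^ k) * ∑[ z ∈ allInputs m c ] (jointEvents S y z ^ k)
    ≤⟨ *-mono-≤ (agreements-moment (∈-allMatchings⁻ σ∈P) k) (∑-jointEvents^≤ S y∈ k) ⟩
      k ^ k * length P * ((k ^ k) ^ ∣ S ∣ * length P ^ c)
    ≡⟨ interchange (k ^ k) (length P) ((k ^ k) ^ ∣ S ∣) (length P ^ c) ⟩
      (k ^ k) ^ suc ∣ S ∣ * length P ^ suc c ∎
    where
    open ≤-Reasoning
    P = allMatchings m
    σ∈P = proj₁ (∈-allVecs-∷⁻ σ∷y∈)
    y∈ = proj₂ (∈-allVecs-∷⁻ σ∷y∈)
  ∑-jointEvents^≤ {m} {suc c} (false ∷ S) {σ ∷ y} σ∷y∈ k = begin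
      ∑[ z ∈ allInputs m (suc c) ] (jointEvents (false ∷ S) (σ ∷ y) z ^ k)
    ≡⟨ ∑-allVecs-suc P c _ ⟩
      ∑[ τ ∈ P ] ∑[ z ∈ allInputs m c ] (jointEvents S y z ^ k)
    ≤⟨ ∑-mono P (λ _ → ∑-jointEvents^≤ S (proj₂ (∈-allVecs-∷⁻ σ∷y∈)) k) ⟩
      ∑[ τ ∈ P ] ((k ^ k) ^ ∣ S ∣ * length P ^ c)
    ≡⟨ ∑-const P _ ⟩
      length P * ((k ^ k) ^ ∣ S ∣ * length P ^ c)
    ≡⟨ x∙yz≈y∙xz (length P) ((k ^ k) ^ ∣ S ∣) (length P ^ c) ⟩
      (k ^ k) ^ ∣ S ∣ * length P ^ suc c ∎
    where
    open ≤-Reasoning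
    P = allMatchings m

module Classes {m c : ℕ} (msg : AliceInput m c → Message) (S : Subset c) where

  open import Data.Nat using (_+_; _*_; _^_; _≤_)
  open import Data.Nat.Properties hiding (_≟_)
  open import Algebra.Properties.CommutativeSemigroup *-commutativeSemigroup using (interchange)
  open import Relation.Binary.PropositionalEquality using (cong; cong₂; sym; trans; module ≡-Reasoning)
  open NatSum
  open Events

  L : List (AliceInput m c)
  L = allInputs m c

  inClass : Message → AliceInput m c → ℕ
  inClass π y = 𝟙 (eqMsg (msg y) π)

  classSize : Message → ℕ
  classSize π = count (λ y → eqMsg (msg y) π) L

  classHits : Message → VS m S → ℕ
  classHits π v = count (λ y → eqMsg (msg y) π ∧ event S v y) L

  classCollisions : Message → ℕ
  classCollisions π = ∑[ v ∈ allVS m S ] (classHits π v * classHits π v)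

  classSize≡∑ : ∀ π → classSize π ≡ ∑ L (inClass π)
  classSize≡∑ π = count≡∑ (λ y → eqMsg (msg y) π) L

  classCollisions≡∑∑ : ∀ π → classCollisions π
                           ≡ ∑[ y ∈ L ] ∑[ z ∈ L ] (inClass π y * inClass π z * jointEvents S y z)
  classCollisions≡∑∑ π = begin
      ∑[ v ∈ V ] (classHits π v * classHits π v)
    ≡⟨ ∑-cong V (λ v → cong (λ h → h * h)
                           (trans (count≡∑ _ L) (∑-cong L (λ y → 𝟙-∧ (eqMsg (msg y) π) (event S v y))))) ⟩
      ∑[ v ∈ V ] (∑[ y ∈ L ] (w y * e v y) * ∑[ z ∈ L ] (w z * e v z))
    ≡⟨ ∑-cong V (λ v → ∑-*-∑ L L _ _) ⟨
      ∑[ v ∈ V ] ∑[ y ∈ L ] ∑[ z ∈ L ] (w y * e v y * (w z * e v z))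
    ≡⟨ ∑-comm V L _ ⟩
      ∑[ y ∈ L ] ∑[ v ∈ V ] ∑[ z ∈ L ] (w y * e v y * (w z * e v z))
    ≡⟨ ∑-cong L (λ y → ∑-comm V L _) ⟩
      ∑[ y ∈ L ] ∑[ z ∈ L ] ∑[ v ∈ V ] (w y * e v y * (w z * e v z))
    ≡⟨ ∑-cong L (λ y → ∑-cong L (λ z → trans (∑-cong V (λ v → interchange (w y) (e v y) (w z) (e v z)))
                                               (∑-*ˡ V (w y * w z) _))) ⟩
      ∑[ y ∈ L ] ∑[ z ∈ L ] (w y * w z * jointEvents S y z) ∎
    where
    open ≡-Reasoning
    V = allVS m S
    w = inClass π
    e : VS m S → AliceInput m c → ℕ
    e v y = 𝟙 (event S v y)

  classCollisions-∅ : ∣ S ∣ ≡ 0 → ∀ π → classCollisions π ≡ classSize π * classSize π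
  classCollisions-∅ ∣S∣≡0 π = begin
      classCollisions π
    ≡⟨ classCollisions≡∑∑ π ⟩
      ∑[ y ∈ L ] ∑[ z ∈ L ] (inClass π y * inClass π z * jointEvents S y z)
    ≡⟨ ∑-cong L (λ y → ∑-cong L (λ z → trans (cong (inClass π y * inClass π z *_) (jointEvents-∅ S y z ∣S∣≡0))
                                               (*-identityʳ _))) ⟩
      ∑[ y ∈ L ] ∑[ z ∈ L ] (inClass π y * inClass π z)
    ≡⟨ ∑-*-∑ L L (inClass π) (inClass π) ⟩
      ∑ L (inClass π) * ∑ L (inClass π)
    ≡⟨ cong₂ _*_ (classSize≡∑ π) (classSize≡∑ π) ⟨
      classSize π * classSize π ∎
    where open ≡-Reasoning

  classCollisions≤ : ∀ t k π → t ^ k * classCollisions π ≤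
                     t ^ suc k * (classSize π * classSize π) + classSize π * ((suc k ^ suc k) ^ ∣ S ∣ * length L)
  classCollisions≤ t k π = begin
      t ^ k * classCollisions π
    ≡⟨ cong (t ^ k *_) (classCollisions≡∑∑ π) ⟩
      t ^ k * ∑[ y ∈ L ] ∑[ z ∈ L ] (inClass π y * inClass π z * jointEvents S y z)
    ≤⟨ ∑∑-weighted≤ L (inClass π) (jointEvents S) t k _ (λ y → 𝟙≤1 (eqMsg (msg y) π)) moment ⟩
      t ^ suc k * (∑ L (inClass π) * ∑ L (inClass π)) + ∑ L (inClass π) * ((suc k ^ suc k) ^ ∣ S ∣ * length L)
    ≡⟨ cong (λ n → t ^ suc k * (n * n) + n * ((suc k ^ suc k) ^ ∣ S ∣ * length L)) (classSize≡∑ π) ⟨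
      t ^ suc k * (classSize π * classSize π) + classSize π * ((suc k ^ suc k) ^ ∣ S ∣ * length L) ∎
    where
    open ≤-Reasoning
    moment : ∀ y → y ∈ L → ∑[ z ∈ L ] (jointEvents S y z ^ suc k) ≤ (suc k ^ suc k) ^ ∣ S ∣ * length L
    moment y y∈L = ≤-trans (∑-jointEvents^≤ S y∈L (suc k))
                           (≤-reflexive (cong ((suc k ^ suc k) ^ ∣ S ∣ *_) (sym (length-allVecs (allMatchings m) c))))

module BitStrings where

  open import Data.Nat using (_+_; _^_; _≤_; _<_; z≤n; s≤s)
  open import Data.Nat.Properties
  open import Data.List.Membership.Propositional.Properties using (∈-map⁺; ∈-map⁻; ∈-++⁺ˡ; ∈-++⁺ʳ)
  import Data.List.Relation.Unary.All.Properties as All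
  import Data.List.Relation.Unary.Unique.Propositional.Properties as Unique
  open import Data.Product using (_,_)
  open import Relation.Binary.PropositionalEquality using (refl; cong; cong₂; sym; trans)

  bitStrings : ℕ → List Message
  bitStrings zero    = [] ∷ []
  bitStrings (suc C) = [] ∷ map (true ∷_) (bitStrings C) ++ map (false ∷_) (bitStrings C)

  ∈-bitStrings : ∀ C (π : Message) → length π ≤ C → π ∈ bitStrings C
  ∈-bitStrings zero    []          _           = here refl
  ∈-bitStrings (suc C) []          _           = here refl
  ∈-bitStrings (suc C) (true ∷ π)  (s≤s |π|≤C) = there (∈-++⁺ˡ (∈-map⁺ (true ∷_) (∈-bitStrings C π |π|≤C)))
  ∈-bitStrings (suc C) (false ∷ π) (s≤s |π|≤C) =
    there (∈-++⁺ʳ (map (true ∷_) (bitStrings C)) (∈-map⁺ (false ∷_) (∈-bitStrings C π |π|≤C)))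

  bitStrings-unique : ∀ C → Unique (bitStrings C)
  bitStrings-unique zero    = [] ∷ []
  bitStrings-unique (suc C) =
    All.++⁺ (All.map⁺ {xs = bitStrings C} (All.tabulate (λ _ ()))) (All.map⁺ {xs = bitStrings C} (All.tabulate (λ _ ())))
    ∷ Unique.++⁺ (Unique.map⁺ ∷-injectiveʳ (bitStrings-unique C)) (Unique.map⁺ ∷-injectiveʳ (bitStrings-unique C))
                 true≢false
    where
    ∷-injectiveʳ : ∀ {b} {π π′ : Message} → b ∷ π ≡ b ∷ π′ → π ≡ π′
    ∷-injectiveʳ refl = refl
    true≢false : ∀ {π} → ¬ (π ∈ map (true ∷_) (bitStrings C) × π ∈ map (false ∷_) (bitStrings C))
    true≢false (π∈t , π∈f) with ∈-map⁻ (true ∷_) π∈t | ∈-map⁻ (false ∷_) π∈f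
    ... | _ , _ , refl | _ , _ , ()

  length-bitStrings< : ∀ C → length (bitStrings C) < 2 ^ suc C
  length-bitStrings< zero    = s≤s (s≤s z≤n)
  length-bitStrings< (suc C) = begin-strict
      length (bitStrings (suc C))
    ≡⟨ cong suc (trans (List.length-++ (map (true ∷_) (bitStrings C)))
                       (cong₂ _+_ (List.length-map _ (bitStrings C)) (List.length-map _ (bitStrings C)))) ⟩
      suc (ℓ + ℓ)
    <⟨ s≤s (≤-reflexive (sym (+-suc ℓ ℓ))) ⟩
      suc ℓ + suc ℓ
    ≤⟨ +-mono-≤ (length-bitStrings< C) (≤-trans (length-bitStrings< C) (≤-reflexive (sym (+-identityʳ _)))) ⟩
      2 ^ suc (suc C) ∎
    where
    open ≤-Reasoning
    ℓ = length (bitStrings C)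

module Rationals where

  import Data.Nat as ℕ
  import Data.Nat.Properties as ℕ
  open import Data.Nat.Coprimality as Coprime using (Coprime)
  open import Data.Integer as ℤ using (+_)
  import Data.Integer.Properties as ℤ
  open import Data.Rational as ℚ using (0ℚ; 1ℚ; mkℚ; _+_; _*_; _≤_; *≤*; nonNegative)
  open import Data.Rational.Properties
  open import Relation.Binary.PropositionalEquality using (refl; cong; cong₂; sym; trans)
  open import Data.Rational.Solver using (module +-*-Solver)
  open import Algebra.Properties.CommutativeSemigroup ℕ.*-commutativeSemigroup using (x∙yz≈y∙xz)
  open +-*-Solver using (solve; _:+_; _:*_; _:=_)

  -- toℚ and ratio normalise; on coprime data they are literal mkℚ's, on which ℚ's operations compute.
  private
    toℚ≡mkℚ : ∀ n → toℚ n ≡ mkℚ (+ n) 0 (Coprime.sym (Coprime.1-coprimeTo n))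
    toℚ≡mkℚ n = normalize-coprime _

    ratio1≡mkℚ : ∀ n → ratio 1 (suc n) ≡ mkℚ (+ 1) n (Coprime.1-coprimeTo (suc n))
    ratio1≡mkℚ n = normalize-coprime _

  toℚ-+ : ∀ a b → toℚ (a ℕ.+ b) ≡ toℚ a + toℚ b
  toℚ-+ a b rewrite toℚ≡mkℚ a | toℚ≡mkℚ b =
    cong (ℚ._/ 1) (trans (ℤ.pos-+ a b) (sym (cong₂ ℤ._+_ (ℤ.*-identityʳ (+ a)) (ℤ.*-identityʳ (+ b)))))

  toℚ-* : ∀ a b → toℚ (a ℕ.* b) ≡ toℚ a * toℚ b
  toℚ-* a b rewrite toℚ≡mkℚ a | toℚ≡mkℚ b = cong (ℚ._/ 1) (ℤ.pos-* a b)

  toℚ-^ : ∀ a n → toℚ (a ℕ.^ n) ≡ toℚ a ^ℚ n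
  toℚ-^ a zero    = refl
  toℚ-^ a (suc n) = trans (toℚ-* a (a ℕ.^ n)) (cong (toℚ a *_) (toℚ-^ a n))

  toℚ-mono-≤ : ∀ {a b} → a ℕ.≤ b → toℚ a ≤ toℚ b
  toℚ-mono-≤ {a} {b} a≤b rewrite toℚ≡mkℚ a | toℚ≡mkℚ b = *≤* (ℤ.*-monoʳ-≤-nonNeg (+ 1) (ℤ.+≤+ a≤b))

  toℚ-nonNeg : ∀ n → 0ℚ ≤ toℚ n
  toℚ-nonNeg n = toℚ-mono-≤ {0} {n} ℕ.z≤n

  ratio-nonNeg : ∀ a n → 0ℚ ≤ ratio a n
  ratio-nonNeg a zero    = ≤-refl
  ratio-nonNeg a (suc n) = nonNegative⁻¹ (+ a ℚ./ suc n) {{normalize-nonNeg a (suc n)}}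

  ratio≡toℚ*ratio1 : ∀ a n → ratio a n ≡ toℚ a * ratio 1 n
  ratio≡toℚ*ratio1 a zero    = sym (*-zeroʳ (toℚ a))
  ratio≡toℚ*ratio1 a (suc n) rewrite toℚ≡mkℚ a | ratio1≡mkℚ n =
    /-cong (sym (ℤ.*-identityʳ (+ a))) (sym (ℕ.+-identityʳ (suc n)))

  toℚ*ratio1≡1 : ∀ n .{{_ : ℕ.NonZero n}} → toℚ n * ratio 1 n ≡ 1ℚ
  toℚ*ratio1≡1 (suc n) rewrite toℚ≡mkℚ (suc n) | ratio1≡mkℚ n =
    *-inverseʳ (mkℚ (+ suc n) 0 (Coprime.sym (Coprime.1-coprimeTo (suc n))))

  toℚ*ratio1≤1 : ∀ n → toℚ n * ratio 1 n ≤ 1ℚ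
  toℚ*ratio1≤1 zero    = toℚ-mono-≤ {0} {1} ℕ.z≤n
  toℚ*ratio1≤1 (suc n) = ≤-reflexive (toℚ*ratio1≡1 (suc n))

  -- Over ℚ, ∑ xs f unfolds to sumℚ (map f xs), the form in which Defs writes its sums.
  module ℚ∑ where
    open FiniteSum (CommutativeRing.commutativeSemiring +-*-commutativeRing) public
    open Monotone {_≤_ = _≤_} ≤-refl +-mono-≤ public

  toℚ-∑ : ∀ {A : Set} (xs : List A) (f : A → ℕ) → toℚ (NatSum.∑ xs f) ≡ sumℚ (map (toℚ ∘ f) xs)
  toℚ-∑ []       f = refl
  toℚ-∑ (x ∷ xs) f = trans (toℚ-+ (f x) _) (cong (λ s → toℚ (f x) + s) (toℚ-∑ xs f))

  toℚ-𝟙 : ∀ b → toℚ (NatSum.𝟙 b) ≡ ℚ∑.𝟙 b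
  toℚ-𝟙 true  = refl
  toℚ-𝟙 false = refl

  *-mono-≤-nonNeg : ∀ {x y u v} → 0ℚ ≤ x → 0ℚ ≤ u → x ≤ y → u ≤ v → x * u ≤ y * v
  *-mono-≤-nonNeg {y = y} {u} 0≤x 0≤u x≤y u≤v =
    ≤-trans (*-monoʳ-≤-nonNeg u {{nonNegative 0≤u}} x≤y) (*-monoˡ-≤-nonNeg y {{nonNegative (≤-trans 0≤x x≤y)}} u≤v)

  *-nonNeg : ∀ {x y} → 0ℚ ≤ x → 0ℚ ≤ y → 0ℚ ≤ x * y
  *-nonNeg 0≤x 0≤y = ≤-trans (≤-reflexive (sym (*-zeroˡ 0ℚ))) (*-mono-≤-nonNeg ≤-refl ≤-refl 0≤x 0≤y)

  ^ℚ-nonNeg : ∀ n {x} → 0ℚ ≤ x → 0ℚ ≤ x ^ℚ n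
  ^ℚ-nonNeg zero    0≤x = toℚ-nonNeg 1
  ^ℚ-nonNeg (suc n) 0≤x = *-nonNeg 0≤x (^ℚ-nonNeg n 0≤x)

  ^ℚ-mono-≤ : ∀ n {x y} → 0ℚ ≤ x → x ≤ y → x ^ℚ n ≤ y ^ℚ n
  ^ℚ-mono-≤ zero    0≤x x≤y = ≤-refl
  ^ℚ-mono-≤ (suc n) 0≤x x≤y = *-mono-≤-nonNeg 0≤x (^ℚ-nonNeg n 0≤x) x≤y (^ℚ-mono-≤ n 0≤x x≤y)

  toℚ≤ratio : ∀ {a p} q .{{_ : ℕ.NonZero q}} → a ℕ.* q ℕ.≤ p → toℚ a ≤ ratio p q
  toℚ≤ratio {a} {p} q aq≤p = begin
      toℚ a                            ≡⟨ *-identityʳ (toℚ a) ⟨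
      toℚ a * 1ℚ                       ≡⟨ cong (toℚ a *_) (toℚ*ratio1≡1 q) ⟨
      toℚ a * (toℚ q * ratio 1 q)      ≡⟨ trans (cong (_* ratio 1 q) (toℚ-* a q)) (*-assoc (toℚ a) (toℚ q) (ratio 1 q)) ⟨
      toℚ (a ℕ.* q) * ratio 1 q        ≤⟨ *-monoʳ-≤-nonNeg (ratio 1 q) {{nonNegative (ratio-nonNeg 1 q)}} (toℚ-mono-≤ aq≤p) ⟩
      toℚ p * ratio 1 q                ≡⟨ ratio≡toℚ*ratio1 p q ⟨
      ratio p q                        ∎
    where open ≤-Reasoning

  ÷-square : ∀ {b w a z} n → b ℕ.* w ℕ.≤ a ℕ.* (n ℕ.* n) ℕ.+ n ℕ.* z →
             toℚ b * (toℚ w * (ratio 1 n * ratio 1 n)) ≤ toℚ a + toℚ z * ratio 1 n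
  ÷-square {b} {w} {a} {z} zero _ = begin
      toℚ b * (toℚ w * (0ℚ * 0ℚ))  ≡⟨ trans (cong (toℚ b *_) (*-zeroʳ (toℚ w))) (*-zeroʳ (toℚ b)) ⟩
      0ℚ                           ≤⟨ toℚ-nonNeg a ⟩
      toℚ a                        ≡⟨ trans (cong (λ r → toℚ a + r) (*-zeroʳ (toℚ z))) (+-identityʳ (toℚ a)) ⟨
      toℚ a + toℚ z * 0ℚ           ∎
    where open ≤-Reasoning
  ÷-square {b} {w} {a} {z} n@(suc _) bw≤ = begin
      toℚ b * (toℚ w * (ρ * ρ))
    ≡⟨ *-assoc (toℚ b) (toℚ w) (ρ * ρ) ⟨
      toℚ b * toℚ w * (ρ * ρ)
    ≡⟨ cong (_* (ρ * ρ)) (toℚ-* b w) ⟨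
      toℚ (b ℕ.* w) * (ρ * ρ)
    ≤⟨ *-monoʳ-≤-nonNeg (ρ * ρ) {{nonNegative (*-nonNeg (ratio-nonNeg 1 n) (ratio-nonNeg 1 n))}} (toℚ-mono-≤ bw≤) ⟩
      toℚ (a ℕ.* (n ℕ.* n) ℕ.+ n ℕ.* z) * (ρ * ρ)
    ≡⟨ cong (_* (ρ * ρ)) (trans (toℚ-+ (a ℕ.* (n ℕ.* n)) (n ℕ.* z))
                               (cong₂ _+_ (trans (toℚ-* a (n ℕ.* n)) (cong (toℚ a *_) (toℚ-* n n))) (toℚ-* n z))) ⟩
      (toℚ a * (toℚ n * toℚ n) + toℚ n * toℚ z) * (ρ * ρ)
    ≡⟨ regroup (toℚ a) (toℚ n) (toℚ z) ρ ⟩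
      toℚ a * ((toℚ n * ρ) * (toℚ n * ρ)) + toℚ z * (toℚ n * ρ) * ρ
    ≡⟨ cong (λ r → toℚ a * (r * r) + toℚ z * r * ρ) (toℚ*ratio1≡1 n) ⟩
      toℚ a * (1ℚ * 1ℚ) + toℚ z * 1ℚ * ρ
    ≡⟨ cong₂ _+_ (*-identityʳ (toℚ a)) (cong (_* ρ) (*-identityʳ (toℚ z))) ⟩
      toℚ a + toℚ z * ρ ∎
    where
    open ≤-Reasoning
    ρ = ratio 1 n
    regroup : ∀ A N Z R → (A * (N * N) + N * Z) * (R * R) ≡ A * ((N * R) * (N * R)) + Z * (N * R) * R
    regroup = solve 4 (λ A N Z R → (A :* (N :* N) :+ N :* Z) :* (R :* R) := A :* ((N :* R) :* (N :* R)) :+ Z :* (N :* R) :* R) refl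

  average-≤ : ∀ {s} b N t .{{_ : ℕ.NonZero b}} → toℚ b * s ≤ toℚ (N ℕ.* (b ℕ.* t)) → ratio 1 N * s ≤ toℚ t
  average-≤ {s} b N t bs≤ = begin
      ratio 1 N * s
    ≤⟨ *-monoˡ-≤-nonNeg (ratio 1 N) {{nonNegative (ratio-nonNeg 1 N)}} s≤Nt ⟩
      ratio 1 N * toℚ (N ℕ.* t)
    ≡⟨ trans (cong (ratio 1 N *_) (toℚ-* N t))
             (trans (sym (*-assoc (ratio 1 N) (toℚ N) (toℚ t))) (cong (_* toℚ t) (*-comm (ratio 1 N) (toℚ N)))) ⟩
      toℚ N * ratio 1 N * toℚ t
    ≤⟨ *-monoʳ-≤-nonNeg (toℚ t) {{nonNegative (toℚ-nonNeg t)}} (toℚ*ratio1≤1 N) ⟩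
      1ℚ * toℚ t
    ≡⟨ *-identityˡ (toℚ t) ⟩
      toℚ t ∎
    where
    open ≤-Reasoning
    s≤Nt : s ≤ toℚ (N ℕ.* t)
    s≤Nt = begin
        s                                    ≡⟨ trans (cong (_* s) b⁻¹b≡1) (*-identityˡ s) ⟨
        ratio 1 b * toℚ b * s                ≡⟨ *-assoc (ratio 1 b) (toℚ b) s ⟩
        ratio 1 b * (toℚ b * s)              ≤⟨ *-monoˡ-≤-nonNeg (ratio 1 b) {{nonNegative (ratio-nonNeg 1 b)}} bs≤ ⟩
        ratio 1 b * toℚ (N ℕ.* (b ℕ.* t))    ≡⟨ cong (ratio 1 b *_) (trans (cong toℚ (x∙yz≈y∙xz N b t)) (toℚ-* b _)) ⟩
        ratio 1 b * (toℚ b * toℚ (N ℕ.* t))  ≡⟨ *-assoc (ratio 1 b) (toℚ b) (toℚ (N ℕ.* t)) ⟨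
        ratio 1 b * toℚ b * toℚ (N ℕ.* t)    ≡⟨ trans (cong (_* toℚ (N ℕ.* t)) b⁻¹b≡1) (*-identityˡ _) ⟩
        toℚ (N ℕ.* t)                        ∎
      where
      b⁻¹b≡1 : ratio 1 b * toℚ b ≡ 1ℚ
      b⁻¹b≡1 = trans (*-comm (ratio 1 b) (toℚ b)) (toℚ*ratio1≡1 b)

module ExpectedCollision {m c : ℕ} (msg : AliceInput m c → Message) (S : Subset c) where

  import Data.Nat as ℕ
  import Data.Nat.Properties as ℕ
  open import Data.Rational as ℚ using (ℚ; 1ℚ; _+_; _*_; _≤_; nonNegative)
  open import Data.Rational.Properties
  open import Algebra.Properties.CommutativeSemigroup (CommutativeRing.*-commutativeSemigroup +-*-commutativeRing)
    using (interchange)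
  open import Algebra.Properties.CommutativeSemigroup ℕ.*-commutativeSemigroup using (x∙yz≈y∙xz)
  import Data.Bool.Properties as Bool
  open import Data.List.Properties using (≡-dec)
  open import Relation.Binary.PropositionalEquality using (cong; cong₂; sym; trans; module ≡-Reasoning)
  open Rationals
  open Arithmetic using (collision-budget; double≤)
  open Classes msg S
  open BitStrings

  ∑p² : AliceInput m c → ℚ
  ∑p² x = sumℚ (map (λ v → pS msg S v (msg x) ^ℚ 2) (allVS m S))

  ∑p²≡ : ∀ x → ∑p² x ≡ toℚ (classCollisions (msg x)) * (ratio 1 (classSize (msg x)) * ratio 1 (classSize (msg x)))
  ∑p²≡ x = trans (ℚ∑.∑-cong (allVS m S) square)
                 (trans (ℚ∑.∑-*ʳ (allVS m S) (ρ * ρ) _) (cong (_* (ρ * ρ)) (sym (toℚ-∑ (allVS m S) _))))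
    where
    π = msg x
    ρ = ratio 1 (classSize π)
    square : ∀ v → ratio (classHits π v) (classSize π) ^ℚ 2 ≡ toℚ (classHits π v ℕ.* classHits π v) * (ρ * ρ)
    square v = begin
        r * (r * 1ℚ)
      ≡⟨ cong (r *_) (*-identityʳ r) ⟩
        r * r
      ≡⟨ cong (λ r → r * r) (ratio≡toℚ*ratio1 h (classSize π)) ⟩
        toℚ h * ρ * (toℚ h * ρ)
      ≡⟨ interchange (toℚ h) ρ (toℚ h) ρ ⟩
        toℚ h * toℚ h * (ρ * ρ)
      ≡⟨ cong (_* (ρ * ρ)) (toℚ-* h h) ⟨
        toℚ (h ℕ.* h) * (ρ * ρ) ∎
      where
      open ≡-Reasoning
      h = classHits π v
      r = ratio h (classSize π)

  ∑-ratio1-classSize≤ : ∀ {C} → (∀ x → length (msg x) ℕ.≤ C) →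
                        sumℚ (map (λ x → ratio 1 (classSize (msg x))) L) ≤ toℚ (length (bitStrings C))
  ∑-ratio1-classSize≤ {C} |msg|≤C = begin
      sumℚ (map (λ x → h (msg x)) L)
    ≡⟨ ℚ∑.∑-cong L (λ x → ℚ∑.∑-𝟙-≟ (≡-dec Bool._≟_) (bitStrings-unique C)
                                    (∈-bitStrings C (msg x) (|msg|≤C x)) h) ⟨
      sumℚ (map (λ x → sumℚ (map (λ π → ℚ∑.𝟙 (eqMsg (msg x) π) * h π) U)) L)
    ≡⟨ ℚ∑.∑-comm L U _ ⟩
      sumℚ (map (λ π → sumℚ (map (λ x → ℚ∑.𝟙 (eqMsg (msg x) π) * h π) L)) U)
    ≡⟨ ℚ∑.∑-cong U (λ π → trans (ℚ∑.∑-*ʳ L (h π) _) (cong (_* h π) (sym (toℚ-classSize π)))) ⟩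
      sumℚ (map (λ π → toℚ (classSize π) * h π) U)
    ≤⟨ ℚ∑.∑-mono U (λ π → toℚ*ratio1≤1 (classSize π)) ⟩
      sumℚ (map (λ _ → 1ℚ) U)
    ≡⟨ trans (cong toℚ (NatSum.length≡∑1 U)) (toℚ-∑ U (λ _ → 1)) ⟨
      toℚ (length U) ∎
    where
    open ≤-Reasoning
    U = bitStrings C
    h : Message → ℚ
    h π = ratio 1 (classSize π)
    toℚ-classSize : ∀ π → toℚ (classSize π) ≡ sumℚ (map (λ x → ℚ∑.𝟙 (eqMsg (msg x) π)) L)
    toℚ-classSize π = trans (cong toℚ (classSize≡∑ π))
                            (trans (toℚ-∑ L (inClass π)) (ℚ∑.∑-cong L (λ x → toℚ-𝟙 (eqMsg (msg x) π))))

  ∑-∑p²≤ : ∀ {C} b a z →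
           (∀ π → b ℕ.* classCollisions π ℕ.≤ a ℕ.* (classSize π ℕ.* classSize π) ℕ.+ classSize π ℕ.* z) →
           (∀ x → length (msg x) ℕ.≤ C) →
           toℚ b * sumℚ (map ∑p² L) ≤ toℚ (length L ℕ.* a ℕ.+ z ℕ.* 2 ℕ.^ suc C)
  ∑-∑p²≤ {C} b a z per-class |msg|≤C = begin
      toℚ b * sumℚ (map ∑p² L)
    ≡⟨ ℚ∑.∑-*ˡ L (toℚ b) ∑p² ⟨
      sumℚ (map (λ x → toℚ b * ∑p² x) L)
    ≤⟨ ℚ∑.∑-mono L (λ x → ≤-trans (≤-reflexive (cong (toℚ b *_) (∑p²≡ x)))
                                  (÷-square {b} {classCollisions (msg x)} {a} {z} (classSize (msg x))
                                            (per-class (msg x)))) ⟩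
      sumℚ (map (λ x → toℚ a + toℚ z * ratio 1 (classSize (msg x))) L)
    ≡⟨ trans (ℚ∑.∑-+ L _ _) (cong₂ _+_ (sym (toℚ-∑ L (λ _ → a))) (ℚ∑.∑-*ˡ L (toℚ z) _)) ⟩
      toℚ (NatSum.∑ L (λ _ → a)) + toℚ z * sumℚ (map (λ x → ratio 1 (classSize (msg x))) L)
    ≤⟨ +-monoʳ-≤ (toℚ (NatSum.∑ L (λ _ → a)))
                 (*-monoˡ-≤-nonNeg (toℚ z) {{nonNegative (toℚ-nonNeg z)}} (∑-ratio1-classSize≤ |msg|≤C)) ⟩
      toℚ (NatSum.∑ L (λ _ → a)) + toℚ z * toℚ (length (bitStrings C))
    ≡⟨ trans (cong₂ _+_ (cong toℚ (NatSum.∑-const L a)) (sym (toℚ-* z (length (bitStrings C)))))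
             (sym (toℚ-+ (length L ℕ.* a) (z ℕ.* length (bitStrings C)))) ⟩
      toℚ (length L ℕ.* a ℕ.+ z ℕ.* length (bitStrings C))
    ≤⟨ toℚ-mono-≤ (ℕ.+-monoʳ-≤ (length L ℕ.* a) (ℕ.*-monoʳ-≤ z (ℕ.<⇒≤ (length-bitStrings< C)))) ⟩
      toℚ (length L ℕ.* a ℕ.+ z ℕ.* 2 ℕ.^ suc C) ∎
    where open ≤-Reasoning

  expectedCollision-∅ : ∀ {C} → (∀ x → length (msg x) ℕ.≤ C) → ∣ S ∣ ≡ 0 → expectedCollision msg S ≤ 1ℚ
  expectedCollision-∅ {C} |msg|≤C ∣S∣≡0 =
    average-≤ 1 (length L) 1 (≤-trans (∑-∑p²≤ 1 1 0 one-class |msg|≤C) (toℚ-mono-≤ (ℕ.≤-reflexive N*1+0≡N*1)))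
    where
    one-class : ∀ π → 1 ℕ.* classCollisions π ℕ.≤ 1 ℕ.* (classSize π ℕ.* classSize π) ℕ.+ classSize π ℕ.* 0
    one-class π = ℕ.≤-trans (ℕ.≤-reflexive (cong (1 ℕ.*_) (classCollisions-∅ ∣S∣≡0 π))) (ℕ.m≤m+n _ _)
    N*1+0≡N*1 : length L ℕ.* 1 ℕ.+ 0 ℕ.* 2 ℕ.^ suc C ≡ length L ℕ.* (1 ℕ.* 1)
    N*1+0≡N*1 = ℕ.+-identityʳ _

  -- With t = (2(C+1))^|S|, collision-budget bounds the moment term by t.
  expectedCollision≤2T : ∀ {C} → (∀ x → length (msg x) ℕ.≤ C) → .{{_ : ℕ.NonZero ∣ S ∣}} →
                         expectedCollision msg S ≤ toℚ ((2 ℕ.* suc C) ℕ.^ ∣ S ∣ ℕ.+ (2 ℕ.* suc C) ℕ.^ ∣ S ∣)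
  expectedCollision≤2T {C} |msg|≤C =
    average-≤ (T ℕ.^ C) N (T ℕ.+ T)
              (≤-trans (∑-∑p²≤ (T ℕ.^ C) (T ℕ.^ suc C) (K ℕ.* N) (classCollisions≤ T C) |msg|≤C) (toℚ-mono-≤ budget))
    where
    T = (2 ℕ.* suc C) ℕ.^ ∣ S ∣
    K = (suc C ℕ.^ suc C) ℕ.^ ∣ S ∣
    N = length L
    instance
      T^C≢0 : ℕ.NonZero (T ℕ.^ C)
      T^C≢0 = ℕ.m^n≢0 T C {{ℕ.m^n≢0 (2 ℕ.* suc C) ∣ S ∣}}
    budget : N ℕ.* T ℕ.^ suc C ℕ.+ K ℕ.* N ℕ.* 2 ℕ.^ suc C ℕ.≤ N ℕ.* (T ℕ.^ C ℕ.* (T ℕ.+ T))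
    budget = begin
        N ℕ.* T ℕ.^ suc C ℕ.+ K ℕ.* N ℕ.* 2 ℕ.^ suc C
      ≡⟨ cong (N ℕ.* T ℕ.^ suc C ℕ.+_) (trans (ℕ.*-assoc K N _) (x∙yz≈y∙xz K N _)) ⟩
        N ℕ.* T ℕ.^ suc C ℕ.+ N ℕ.* (K ℕ.* 2 ℕ.^ suc C)
      ≤⟨ ℕ.+-monoʳ-≤ (N ℕ.* T ℕ.^ suc C) (ℕ.*-monoʳ-≤ N (collision-budget (suc C) ∣ S ∣)) ⟩
        N ℕ.* T ℕ.^ suc C ℕ.+ N ℕ.* T ℕ.^ suc C
      ≡⟨ ℕ.*-distribˡ-+ N _ _ ⟨
        N ℕ.* (T ℕ.^ suc C ℕ.+ T ℕ.^ suc C)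
      ≡⟨ cong (N ℕ.*_) (trans (cong₂ ℕ._+_ (ℕ.*-comm T _) (ℕ.*-comm T _)) (sym (ℕ.*-distribˡ-+ (T ℕ.^ C) T T))) ⟩
        N ℕ.* (T ℕ.^ C ℕ.* (T ℕ.+ T)) ∎
      where open ℕ.≤-Reasoning

  expectedCollision≤ : ∀ {C} → (∀ x → length (msg x) ℕ.≤ C) →
                       expectedCollision msg S ≤ toℚ (4 ℕ.* suc C) ^ℚ ∣ S ∣
  expectedCollision≤ {C} |msg|≤C with ∣ S ∣ ℕ.≟ 0
  ... | yes ∣S∣≡0 =
    ≤-trans (expectedCollision-∅ |msg|≤C ∣S∣≡0) (≤-reflexive (cong (toℚ (4 ℕ.* suc C) ^ℚ_) (sym ∣S∣≡0)))
  ... | no ∣S∣≢0  = begin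
      expectedCollision msg S                                         ≤⟨ expectedCollision≤2T |msg|≤C ⟩
      toℚ ((2 ℕ.* suc C) ℕ.^ ∣ S ∣ ℕ.+ (2 ℕ.* suc C) ℕ.^ ∣ S ∣)     ≤⟨ toℚ-mono-≤ (double≤ (suc C) ∣ S ∣) ⟩
      toℚ ((4 ℕ.* suc C) ℕ.^ ∣ S ∣)                                  ≡⟨ toℚ-^ (4 ℕ.* suc C) ∣ S ∣ ⟩
      toℚ (4 ℕ.* suc C) ^ℚ ∣ S ∣                                     ∎
    where
    open ≤-Reasoning
    instance
      ∣S∣-nonZero : ℕ.NonZero ∣ S ∣
      ∣S∣-nonZero = ℕ.≢-nonZero ∣S∣≢0

module Gamma where

  open import Data.Nat using (_+_; _*_; _^_; _≤_; _<_; NonZero; >-nonZero)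
  open import Data.Nat.Properties
  open import Data.Nat.Solver using (module +-*-Solver)
  import Data.Rational as ℚ
  import Data.Rational.Properties as ℚ
  open import Relation.Binary.PropositionalEquality using (refl)
  open +-*-Solver using (solve; _:*_; _:=_; con)
  open Arithmetic
  open Rationals

  -- Γ² = 32 m (C + log m) ≥ 32 m C ≥ 16 C², as 512 C < m.
  4C*q≤p : ∀ m C p q → 0 < m → GammaLtQuarter m C → GammaLe m C p q → 4 * C * q ≤ p
  4C*q≤p m C p q 0<m Γ<m/4 Γ≤p/q = square-reflects-≤ (begin
      4 * C * q * (4 * C * q)
    ≡⟨ regroup C q ⟩
      C * (16 * C * (q * q))
    ≤⟨ *-monoʳ-≤ C (*-monoˡ-≤ (q * q) 16C≤32m) ⟩
      C * e
    ≤⟨ 2^-reflects-≤ (begin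
          2 ^ (C * e)      ≡⟨ ^-*-assoc 2 C e ⟨
          (2 ^ C) ^ e      ≤⟨ ^-monoˡ-≤ e (m≤m*n (2 ^ C) m) ⟩
          (2 ^ C * m) ^ e  ≤⟨ Γ≤p/q ⟩
          2 ^ (p * p)      ∎) ⟩
      p * p ∎)
    where
    open ≤-Reasoning
    instance
      m-nonZero : NonZero m
      m-nonZero = >-nonZero 0<m
    e = 32 * m * (q * q)
    512C<m : 512 * C < m
    512C<m = 2^-reflects-< (≤-<-trans (m≤m*n (2 ^ (512 * C)) (m ^ 512) {{m^n≢0 m 512}}) Γ<m/4)
    16C≤32m : 16 * C ≤ 32 * m
    16C≤32m = ≤-trans (*-monoˡ-≤ C (≤ᵇ⇒≤ 16 512 _)) (≤-trans (<⇒≤ 512C<m) (m≤n*m m 32))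
    regroup : ∀ C q → 4 * C * q * (4 * C * q) ≡ C * (16 * C * (q * q))
    regroup = solve 2 (λ C q → con 4 :* C :* q :* (con 4 :* C :* q) := C :* (con 16 :* C :* (q :* q))) refl

  4[C+1]≤p/q+6 : ∀ C p q .{{_ : NonZero q}} → 4 * C * q ≤ p → toℚ (4 * suc C) ℚ.≤ ratio p q ℚ.+ toℚ 6
  4[C+1]≤p/q+6 C p q 4Cq≤p = begin
      toℚ (4 * suc C)        ≤⟨ toℚ-mono-≤ (≤-trans (≤-reflexive (*-suc 4 C)) (+-monoˡ-≤ (4 * C) (≤ᵇ⇒≤ 4 6 _))) ⟩
      toℚ (6 + 4 * C)        ≡⟨ toℚ-+ 6 (4 * C) ⟩
      toℚ 6 ℚ.+ toℚ (4 * C)  ≤⟨ ℚ.+-monoʳ-≤ (toℚ 6) (toℚ≤ratio {4 * C} q 4Cq≤p) ⟩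
      toℚ 6 ℚ.+ ratio p q    ≡⟨ ℚ.+-comm (toℚ 6) (ratio p q) ⟩
      ratio p q ℚ.+ toℚ 6    ∎
    where open ℚ.≤-Reasoning

open import Data.Nat as ℕ using (_<_; _≤_)
open import Data.Rational using (_+_) renaming (_≤_ to _≤ℚ_)
open import Data.Rational.Properties using (module ≤-Reasoning)
open ExpectedCollision using (expectedCollision≤)
open Rationals using (^ℚ-mono-≤; toℚ-nonNeg)
open Gamma using (4C*q≤p; 4[C+1]≤p/q+6)

lemma4p4 : (m c C : ℕ) → 0 < m → 0 < c → 0 < C →
    GammaLtQuarter m C →
    (msg : AliceInput m c → Message) → (∀ x → length (msg x) ≤ C) →
    (S : Subset c) →
    (p q : ℕ) → 0 < q → GammaLe m C p q →
    expectedCollision msg S ≤ℚ (ratio p q + toℚ 6) ^ℚ ∣ S ∣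
lemma4p4 m c C 0<m _ _ Γ<m/4 msg |msg|≤C S p q 0<q Γ≤p/q = begin
    expectedCollision msg S        ≤⟨ expectedCollision≤ msg S |msg|≤C ⟩
    toℚ (4 ℕ.* suc C) ^ℚ ∣ S ∣     ≤⟨ ^ℚ-mono-≤ ∣ S ∣ (toℚ-nonNeg (4 ℕ.* suc C)) 4[C+1]≤Γ+6 ⟩
    (ratio p q + toℚ 6) ^ℚ ∣ S ∣   ∎
  where
  open ≤-Reasoning
  4[C+1]≤Γ+6 : toℚ (4 ℕ.* suc C) ≤ℚ ratio p q + toℚ 6
  4[C+1]≤Γ+6 = 4[C+1]≤p/q+6 C p q {{ℕ.>-nonZero 0<q}} (4C*q≤p m C p q 0<m Γ<m/4 Γ≤p/q)
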